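{- Let $n\ge1$, let $w=w_1\cdots w_n$ be a parking function of size $n$, and let $D$ be its labeled Dyck path. Then the number of degrees of freedom of the region $\omega(w)$ of $\mathsf{Shi}(n)$ equals the number of prime components of $D$.
   Context: $[n]=\{1,\dots,n\}$. A parking function of size $n$ is $w\in[n]^n$ whose nondecreasing rearrangement $a_1\le\dots\le a_n$ satisfies $a_i\le i$; $\mathsf{Park}_n$ is their set. The labeled Dyck path of $w$ is the lattice path $D$ from $(0,0)$ to $(n,n)$ with unit north and east steps, staying weakly above $y=x$, having for each $x=0,\dots,n-1$ exactly $\#\{i:w_i=x+1\}$ north steps with $x$-coordinate $x$, labeled by the elements of $\{i:w_i=x+1\}$ increasing upward. A return of $D$ is a point $(i,i)$ on $D$ with $0<i<n$; the prime components of $D$ are the pieces into which the returns cut $D$, so their number is one plus the number of returns. In $\mathbb R^n$, $\mathsf{Shi}(n)=\{x_i-x_j=0:1\le i<j\le n\}\cup\{x_i-x_j=1:1\le i<j\le n\}$; regions are connected components of the complement of the union of its hyperplanes; a region $R$ has $d$ degrees of freedom if $\{v:R+v\subseteq R\}$ has dimension $d$. A hyperplane not through the origin is a ceiling of $R$ if it is the affine span of a facet of $\overline R$ and does not separate $R$ from the origin. For a region $R$ let $\pi\in\mathfrak S_n$ satisfy $x_{\pi_1}>\dots>x_{\pi_n}$ on $R$, let $\Pi$ be the partition of $[n]$ generated by $a\sim b$ when $x_{\pi_a}-x_{\pi_b}=1$ is a ceiling of $R$, and let $w(R)_i$ be the least element of the block of $\Pi$ containing $\pi^{ -1}(i)$.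 It is known that $R\mapsto w(R)$ is a bijection from regions of $\mathsf{Shi}(n)$ onto $\mathsf{Park}_n$; $\omega$ denotes its inverse.
   Formalization: Points are taken in ℚ^n instead of ℝ^n, so the regions of $\mathsf{Shi}(n)$, their closures and facets, and the translation sets whose dimension gives the degrees of freedom consist of rational points. -}

module Defs where

open import Data.Nat as ℕ using (ℕ; zero; suc; pred; _≡ᵇ_)
open import Data.Fin as Fin using (Fin; toℕ)
open import Data.Fin.Permutation using (Permutation′; _⟨$⟩ʳ_; _⟨$⟩ˡ_)
open import Data.Rational using (ℚ; 0ℚ; 1ℚ; _+_; _-_; _*_; _<_; ∣_∣)
open import Data.Bool using (Bool; true; false; _∧_; if_then_else_)
open import Data.List using (List; []; _∷_; _++_; concatMap; replicate; scanl; applyUpTo; allFin)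
open import Data.Bool.ListAction using (any)
open import Data.Fin using () renaming (_≟_ to _≟ᶠ_)
open import Data.Product using (Σ; _×_; _,_; proj₁; proj₂)
open import Data.Sum using (_⊎_)
open import Relation.Nullary using (¬_; does)
open import Relation.Binary.PropositionalEquality using (_≡_)
open import Relation.Binary.Construct.Closure.Equivalence using (EqClosure)

sumFin : ∀ {k} → (Fin k → ℚ) → ℚ
sumFin {zero}  f = 0ℚ
sumFin {suc k} f = f Fin.zero + sumFin (λ j → f (Fin.suc j))

countFin : ∀ {k} → (Fin k → Bool) → ℕ
countFin {zero}  p = 0
countFin {suc k} p = (if p Fin.zero then 1 else 0) ℕ.+ countFin (λ j → p (Fin.suc j))

countList : {A : Set} → (A → Bool) → List A → ℕ
countList p []       = 0
countList p (a ∷ as) = (if p a then 1 else 0) ℕ.+ countList p as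

-- A word w ∈ [n]^n is encoded as w : Fin n → Fin n,
-- where the value k : Fin n stands for the letter toℕ k + 1 ∈ [n].
-- Condition: the nondecreasing rearrangement a_1 ≤ … ≤ a_n satisfies
-- a_i ≤ i; the rearrangement is w ∘ σ for a permutation σ.

IsParkingFunction : ∀ {n} → (Fin n → Fin n) → Set
IsParkingFunction {n} w =
  Σ (Permutation′ n) λ σ →
      (∀ (a b : Fin n) → a Fin.≤ b → w (σ ⟨$⟩ʳ a) Fin.≤ w (σ ⟨$⟩ʳ b))
    × (∀ (a : Fin n) → w (σ ⟨$⟩ʳ a) Fin.≤ a)

-- Column x (x = 0,…,n-1) carries #{i : w_i = x+1} north steps, then one
-- east step.  (Labels do not affect returns / prime components.)

data Step : Set where
  north east : Step

multiplicity : ∀ {n} → (Fin n → Fin n) → Fin n → ℕ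
multiplicity w x = countFin (λ i → does (w i ≟ᶠ x))

dyckPath : ∀ {n} → (Fin n → Fin n) → List Step
dyckPath {n} w = concatMap (λ x → replicate (multiplicity w x) north ++ (east ∷ [])) (allFin n)

move : ℕ × ℕ → Step → ℕ × ℕ
move (a , b) north = (a , suc b)
move (a , b) east  = (suc a , b)

pathPoints : List Step → List (ℕ × ℕ)
pathPoints = scanl move (0 , 0)

onDiagonalPoint : List (ℕ × ℕ) → ℕ → Bool
onDiagonalPoint pts i = any (λ p → (proj₁ p ≡ᵇ i) ∧ (proj₂ p ≡ᵇ i)) pts

numReturns : ∀ {n} → (Fin n → Fin n) → ℕ
numReturns {n} w = countList (onDiagonalPoint (pathPoints (dyckPath w))) (applyUpTo suc (pred n))

numPrimeComponents : ∀ {n} → (Fin n → Fin n) → ℕ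
numPrimeComponents w = suc (numReturns w)

Pt : ℕ → Set
Pt n = Fin n → ℚ

origin : ∀ {n} → Pt n
origin _ = 0ℚ

_⊕_ : ∀ {n} → Pt n → Pt n → Pt n
(x ⊕ y) t = x t + y t

_⊖_ : ∀ {n} → Pt n → Pt n → Pt n
(x ⊖ y) t = x t - y t

LinIndep : ∀ {n k} → (Fin k → Pt n) → Set
LinIndep {n} {k} vs =
  ∀ (c : Fin k → ℚ) → (∀ (t : Fin n) → sumFin (λ j → c j * vs j t) ≡ 0ℚ) → ∀ j → c j ≡ 0ℚ

HasDim : ∀ {n} → (Pt n → Set) → ℕ → Set
HasDim {n} S d =
    (Σ (Fin d → Pt n) λ vs → (∀ j → S (vs j)) × LinIndep vs)
  × (∀ (vs : Fin (suc d) → Pt n) → (∀ j → S (vs j)) → ¬ LinIndep vs)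

HasAffIndep : ∀ {n} → (Pt n → Set) → ℕ → Set
HasAffIndep {n} S k =
  Σ (Fin (suc k) → Pt n) λ ps → (∀ j → S (ps j)) × LinIndep (λ (j : Fin k) → ps (Fin.suc j) ⊖ ps Fin.zero)

-- The Shi arrangement: hyperplanes x_i - x_j = c, i < j, c ∈ {0,1}
-- (const = false ↦ c = 0, const = true ↦ c = 1).

record ShiHyp (n : ℕ) : Set where
  constructor hyp
  field
    i j   : Fin n
    i<j   : i Fin.< j
    const : Bool

hval : ∀ {n} → ShiHyp n → Pt n → ℚ
hval (hyp i j _ c) x = x i - x j - (if c then 1ℚ else 0ℚ)

OnHyp : ∀ {n} → ShiHyp n → Pt n → Set
OnHyp H x = hval H x ≡ 0ℚ

Generic : ∀ {n} → Pt n → Set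
Generic x = ∀ H → ¬ OnHyp H x

SameSide : ∀ {n} → ShiHyp n → Pt n → Pt n → Set
SameSide H x y = (hval H x < 0ℚ × hval H y < 0ℚ) ⊎ (0ℚ < hval H x × 0ℚ < hval H y)

-- For generic x, the region of Shi(n) containing x (its rational points):
-- the points on the same (open) side of every hyperplane as x.
InRegion : ∀ {n} → Pt n → Pt n → Set
InRegion x y = ∀ H → SameSide H x y

InClosure : ∀ {n} → Pt n → Pt n → Set
InClosure {n} x y =
  ∀ (ε : ℚ) → 0ℚ < ε → Σ (Pt n) λ z → InRegion x z × (∀ t → ∣ z t - y t ∣ < ε)

Translations : ∀ {n} → Pt n → Pt n → Set
Translations x v = ∀ y → InRegion x y → InRegion x (y ⊕ v)

DegreesOfFreedom : ∀ {n} → Pt n → ℕ → Set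
DegreesOfFreedom x d = HasDim (Translations x) d

-- H is the affine span of a facet of the closure of the region of x:
-- closure ∩ H has affine dimension n-1 (n ≥ 1).
SpansFacet : ∀ {n} → Pt n → ShiHyp n → Set
SpansFacet {n} x H = HasAffIndep (λ y → InClosure x y × OnHyp H y) (pred n)

Ceiling : ∀ {n} → Pt n → ShiHyp n → Set
Ceiling x H = ¬ OnHyp H origin × SpansFacet x H × SameSide H x origin

DecreasingOrder : ∀ {n} → Pt n → Permutation′ n → Set
DecreasingOrder {n} x π = ∀ (a b : Fin n) → a Fin.< b → x (π ⟨$⟩ʳ b) < x (π ⟨$⟩ʳ a)

CeilingRel : ∀ {n} → Pt n → Permutation′ n → Fin n → Fin n → Set
CeilingRel x π a b =
  Σ ((π ⟨$⟩ʳ a) Fin.< (π ⟨$⟩ʳ b)) λ p → Ceiling x (hyp (π ⟨$⟩ʳ a) (π ⟨$⟩ʳ b) p true)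

-- w(R)_i = least element of the block of Π containing π^{-1}(i)
-- (blocks of Π = classes of the equivalence closure of CeilingRel)
ShiParking : ∀ {n} → Pt n → Permutation′ n → (Fin n → Fin n) → Set
ShiParking {n} x π w =
  ∀ (i : Fin n) →
      EqClosure (CeilingRel x π) (w i) (π ⟨$⟩ˡ i)
    × (∀ (c : Fin n) → EqClosure (CeilingRel x π) c (π ⟨$⟩ˡ i) → w i Fin.≤ c)

module Submission where

-- Sort the coordinates of x decreasingly along π, and call a pair p < q of sorted positions tied
-- when the hyperplane x_{π p} - x_{π q} = 1 lies just above the region.  A translation of the region
-- is weakly decreasing in sorted order and constant across a cut 0 < i < n straddled by a tied pair,
-- while the indicator of the first i sorted coordinates is a translation whenever no tied pair
-- straddles i; so the region has 1 + #(open cuts) degrees of freedom.  Ceilings are tied pairs, and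
-- every straddled cut is straddled by a ceiling (push x onto the widest tied pair across it).  As
-- w(R) is constant along ceilings and w_j is at most the sorted position of j, the number of letters
-- of w below i is i when the cut i is open and exceeds i otherwise; that is exactly the condition
-- for the Dyck path of w to return to (i , i).

open import Defs
open import Data.Nat using (ℕ; suc)
open import Data.Fin using (Fin)
open import Data.Fin.Permutation using (Permutation′)

module Rational where

  open import Data.Nat as ℕ using (ℕ; zero; suc; _<ᵇ_)
  import Data.Nat.Properties as ℕ
  open import Data.Nat.Coprimality using (Coprime)
  open import Data.Integer as ℤ using (+[1+_]; -[1+_])
  import Data.Integer.Properties as ℤ
  open import Data.Integer.Tactic.RingSolver using (solve-∀)
  open import Data.Bool using (Bool; true; false; if_then_else_)
  open import Data.Rational as ℚ
    using (ℚ; mkℚ; 0ℚ; 1ℚ; ½; _+_; _-_; _*_; -_; _<_; _≤_; _⊓_; ∣_∣; 1/_; toℚᵘ; +-0-rawMonoid; ≢-nonZero; positive; nonNegative)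
  open import Data.Rational.Properties
  open import Data.Rational.Unnormalised as ℚᵘ using (mkℚᵘ; *≡*; *<*)
  import Data.Rational.Unnormalised.Properties as ℚᵘ
  open import Data.Rational.Solver using (module +-*-Solver)
  open import Algebra.Definitions.RawMonoid +-0-rawMonoid using () renaming (_×_ to _·_) public
  open import Data.List using (List; []; _∷_)
  open import Data.List.Membership.Propositional using (_∈_)
  open import Data.List.Relation.Unary.Any using (here; there)
  open import Data.Product using (∃-syntax; _×_; _,_)
  open import Data.Sum using (inj₁; inj₂)
  open import Relation.Nullary using (¬_; yes; no; contradiction)
  open import Relation.Nullary.Reflects using (ofʸ; ofⁿ)
  open import Relation.Nullary.Decidable using (toWitness)
  open import Relation.Unary using (Decidable)
  open import Relation.Binary.PropositionalEquality

  open +-*-Solver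

  p<q⇒0<q-p : ∀ {p q} → p < q → 0ℚ < q - p
  p<q⇒0<q-p {p} {q} p<q = subst (_< q - p) (+-inverseʳ p) (+-monoˡ-< (- p) p<q)

  0<q-p⇒p<q : ∀ {p q} → 0ℚ < q - p → p < q
  0<q-p⇒p<q {p} {q} h = subst₂ _<_ (+-identityʳ p) (solve 2 (λ p q → p :+ (q :- p) := q) refl p q) (+-monoʳ-< p h)

  0≤q-p⇒p≤q : ∀ {p q} → 0ℚ ≤ q - p → p ≤ q
  0≤q-p⇒p≤q {p} {q} h = subst₂ _≤_ (+-identityʳ p) (solve 2 (λ p q → p :+ (q :- p) := q) refl p q) (+-monoʳ-≤ p h)

  p-q≤0⇒p≤q : ∀ {p q} → p - q ≤ 0ℚ → p ≤ q
  p-q≤0⇒p≤q {p} {q} h = subst₂ _≤_ (solve 2 (λ p q → (p :- q) :+ q := p) refl p q) (+-identityˡ q) (+-monoˡ-≤ q h)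

  p-q<0⇒p<q : ∀ {p q} → p - q < 0ℚ → p < q
  p-q<0⇒p<q {p} {q} h = subst₂ _<_ (solve 2 (λ p q → (p :- q) :+ q := p) refl p q) (+-identityˡ q) (+-monoˡ-< q h)

  p<q⇒p-q<0 : ∀ {p q} → p < q → p - q < 0ℚ
  p<q⇒p-q<0 {p} {q} p<q = subst (p - q <_) (+-inverseʳ q) (+-monoˡ-< (- q) p<q)

  0<½ : 0ℚ < ½
  0<½ = toWitness {a? = 0ℚ <? ½} _

  0<1 : 0ℚ < 1ℚ
  0<1 = toWitness {a? = 0ℚ <? 1ℚ} _

  <⇒≱ : ∀ {p q} → p < q → ¬ q ≤ p
  <⇒≱ p<q q≤p = <-irrefl refl (<-≤-trans p<q q≤p)

  *-pos : ∀ {p q} → 0ℚ < p → 0ℚ < q → 0ℚ < p * q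
  *-pos {p} {q} p>0 q>0 = subst (_< p * q) (*-zeroˡ q) (*-monoˡ-<-pos q p>0)
    where instance _ = positive q>0

  *-nonNeg : ∀ {p q} → 0ℚ ≤ p → 0ℚ ≤ q → 0ℚ ≤ p * q
  *-nonNeg {p} {q} p≥0 q≥0 = subst (_≤ p * q) (*-zeroˡ q) (*-monoʳ-≤-nonNeg q p≥0)
    where instance _ = nonNegative q≥0

  nonNeg+nonNeg : ∀ {u v} → 0ℚ ≤ u → 0ℚ ≤ v → 0ℚ ≤ u + v
  nonNeg+nonNeg {u} {v} 0≤u 0≤v = subst (_≤ u + v) (+-identityʳ 0ℚ) (+-mono-≤ 0≤u 0≤v)

  nonPos+nonPos : ∀ {u v} → u ≤ 0ℚ → v ≤ 0ℚ → u + v ≤ 0ℚ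
  nonPos+nonPos {u} {v} u≤0 v≤0 = subst (u + v ≤_) (+-identityʳ 0ℚ) (+-mono-≤ u≤0 v≤0)

  *-nonPos : ∀ {c u} → 0ℚ ≤ c → u ≤ 0ℚ → c * u ≤ 0ℚ
  *-nonPos {c} {u} 0≤c u≤0 = subst (c * u ≤_) (*-zeroʳ c) (*-monoˡ-≤-nonNeg c u≤0)
    where instance _ = nonNegative 0≤c

  *-≤-self : ∀ {c u} → 0ℚ ≤ c → u ≤ 1ℚ → c * u ≤ c
  *-≤-self {c} {u} 0≤c u≤1 = subst (c * u ≤_) (*-identityʳ c) (*-monoˡ-≤-nonNeg c u≤1)
    where instance _ = nonNegative 0≤c

  half< : ∀ {p} → 0ℚ < p → p * ½ < p
  half< {p} p>0 = 0<q-p⇒p<q (subst (0ℚ <_) (solve 1 (λ p → p :* con ½ := p :- p :* con ½) refl p) (*-pos p>0 0<½))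

  0<⊓ : ∀ {p q} → 0ℚ < p → 0ℚ < q → 0ℚ < p ⊓ q
  0<⊓ {p} {q} p>0 q>0 with ⊓-sel p q
  ... | inj₁ p⊓q≡p = subst (0ℚ <_) (sym p⊓q≡p) p>0
  ... | inj₂ p⊓q≡q = subst (0ℚ <_) (sym p⊓q≡q) q>0

  +-neg-nonPos : ∀ {u v} → u < 0ℚ → v ≤ 0ℚ → u + v < 0ℚ
  +-neg-nonPos {u} {v} u<0 v≤0 = subst (u + v <_) (+-identityʳ 0ℚ) (+-mono-<-≤ u<0 v≤0)

  +-pos-nonNeg : ∀ {u v} → 0ℚ < u → 0ℚ ≤ v → 0ℚ < u + v
  +-pos-nonNeg {u} {v} u>0 v≥0 = subst (_< u + v) (+-identityʳ 0ℚ) (+-mono-<-≤ u>0 v≥0)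

  p≤∣p∣ : ∀ p → p ≤ ∣ p ∣
  p≤∣p∣ p with ∣p∣≡p∨∣p∣≡-p p
  ... | inj₁ ∣p∣≡p  = ≤-reflexive (sym ∣p∣≡p)
  ... | inj₂ ∣p∣≡-p = ≤-trans (p≤0 ∣p∣≡-p) (0≤∣p∣ p)
    where
    p≤0 : ∣ p ∣ ≡ - p → p ≤ 0ℚ
    p≤0 eq = ≮⇒≥ (λ p>0 → <-irrefl refl (≤-<-trans (subst (0ℚ ≤_) eq (0≤∣p∣ p)) (neg-antimono-< p>0)))

  -p≤∣p∣ : ∀ p → - p ≤ ∣ p ∣
  -p≤∣p∣ p = subst (- p ≤_) (∣-p∣≡∣p∣ p) (p≤∣p∣ (- p))

  ∣p∣≡-p : ∀ {p} → p < 0ℚ → ∣ p ∣ ≡ - p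
  ∣p∣≡-p {p} p<0 = trans (sym (∣-p∣≡∣p∣ p)) (0≤p⇒∣p∣≡p (<⇒≤ (neg-antimono-< p<0)))

  ∣p∣≤r : ∀ {p r} → p ≤ r → - p ≤ r → ∣ p ∣ ≤ r
  ∣p∣≤r {p} p≤r -p≤r with ∣p∣≡p∨∣p∣≡-p p
  ... | inj₁ ∣p∣≡p  = subst (_≤ _) (sym ∣p∣≡p) p≤r
  ... | inj₂ ∣p∣≡-p = subst (_≤ _) (sym ∣p∣≡-p) -p≤r

  p-q≤p : ∀ {p q} → 0ℚ ≤ q → p - q ≤ p
  p-q≤p {p} {q} 0≤q = subst (p - q ≤_) (+-identityʳ p) (+-monoʳ-≤ p (neg-antimono-≤ 0≤q))

  ∣p-q∣≤r : ∀ {p q r} → 0ℚ ≤ p → p ≤ r → 0ℚ ≤ q → q ≤ r → ∣ p - q ∣ ≤ r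
  ∣p-q∣≤r {p} {q} 0≤p p≤r 0≤q q≤r = ∣p∣≤r (≤-trans (p-q≤p 0≤q) p≤r)
    (subst (_≤ _) (solve 2 (λ p q → q :- p := :- (p :- q)) refl p q) (≤-trans (p-q≤p 0≤p) q≤r))

  *-cancelʳ-≡0 : ∀ p {q} → q ≢ 0ℚ → p * q ≡ 0ℚ → p ≡ 0ℚ
  *-cancelʳ-≡0 p {q} q≢0 pq≡0 = begin
    p                ≡⟨ *-identityʳ p ⟨
    p * 1ℚ           ≡⟨ cong (p *_) (*-inverseʳ q) ⟨
    p * (q * 1/ q)   ≡⟨ *-assoc p q (1/ q) ⟨
    p * q * 1/ q     ≡⟨ cong (_* 1/ q) pq≡0 ⟩
    0ℚ * 1/ q        ≡⟨ *-zeroˡ (1/ q) ⟩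
    0ℚ               ∎
    where
    open ≡-Reasoning
    instance _ = ≢-nonZero q≢0

  positive-lowerBound : ∀ {A : Set} {P : A → Set} → Decidable P → (f : A → ℚ) (xs : List A) →
                        (∀ a → P a → 0ℚ < f a) → ∃[ μ ] 0ℚ < μ × (∀ a → a ∈ xs → P a → μ ≤ f a)
  positive-lowerBound P? f []       f>0 = 1ℚ , 0<1 , λ _ ()
  positive-lowerBound P? f (a ∷ xs) f>0 with positive-lowerBound P? f xs f>0 | P? a
  ... | μ , μ>0 , μ≤ | no ¬Pa = μ , μ>0 , λ where
    _ (here refl) Pa → contradiction Pa ¬Pa
    b (there b∈)  Pb → μ≤ b b∈ Pb
  ... | μ , μ>0 , μ≤ | yes Pa = f a ⊓ μ , 0<⊓ (f>0 a Pa) μ>0 , λ where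
    _ (here refl) _  → p⊓q≤p (f a) μ
    b (there b∈)  Pb → ≤-trans (p⊓q≤q (f a) μ) (μ≤ b b∈ Pb)

  ·-neg : ∀ m p → m · (- p) ≡ - (m · p)
  ·-neg zero    p = refl
  ·-neg (suc m) p = trans (cong (λ r → - p + r) (·-neg m p)) (sym (neg-distrib-+ p (m · p)))

  private
    ·-toℚᵘ : ∀ m a d .(c : Coprime ℤ.∣ a ∣ (suc d)) → toℚᵘ (m · mkℚ a d c) ℚᵘ.≃ mkℚᵘ (ℤ.+ m ℤ.* a) d
    ·-toℚᵘ zero    a d c = *≡* (cong (ℤ._* +[1+ d ]) (sym (ℤ.*-zeroˡ a)))
    ·-toℚᵘ (suc m) a d c = ℚᵘ.≃-trans (toℚᵘ-homo-+ (mkℚ a d c) (m · mkℚ a d c))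
      (ℚᵘ.≃-trans (ℚᵘ.+-congʳ (mkℚᵘ a d) (·-toℚᵘ m a d c))
                  (*≡* (trans (identity a +[1+ d ] (ℤ.+ m)) (cong (λ k → (k ℤ.* a) ℤ.* (+[1+ d ] ℤ.* +[1+ d ])) (sym (ℤ.pos-+ 1 m))))))
      where
      identity : ∀ a D M → (a ℤ.* D ℤ.+ (M ℤ.* a) ℤ.* D) ℤ.* D ≡ ((ℤ.+ 1 ℤ.+ M) ℤ.* a) ℤ.* (D ℤ.* D)
      identity = solve-∀

  -- For q = a/(b+1) and δ = (e+1)/(d+1), m = (|a| + 1)(d + 1) gives m·δ ≥ |a| + 1 > q.
  archimedean : ∀ q δ → 0ℚ < δ → ∃[ m ] q < m · δ
  archimedean (mkℚ a b _) (mkℚ +[1+ e ] d cd) _ =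
    m a , toℚᵘ-cancel-< (ℚᵘ.<-respʳ-≃ (ℚᵘ.≃-sym (·-toℚᵘ (m a) +[1+ e ] d cd)) (*<* (bound a)))
    where
    m : ℤ.ℤ → ℕ
    m a = suc ℤ.∣ a ∣ ℕ.* suc d
    bound : ∀ a → a ℤ.* +[1+ d ] ℤ.< (ℤ.+ m a ℤ.* +[1+ e ]) ℤ.* +[1+ b ]
    bound (ℤ.+ zero)  = ℤ.+<+ (ℕ.s≤s ℕ.z≤n)
    bound -[1+ _ ]  = ℤ.-<+
    bound +[1+ k ]  = ℤ.+<+ (ℕ.<-≤-trans (ℕ.*-monoˡ-< (suc d) (ℕ.n<1+n (suc k)))
                         (ℕ.≤-trans (ℕ.m≤m*n (suc (suc k) ℕ.* suc d) (suc e))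
                                    (ℕ.m≤m*n (suc (suc k) ℕ.* suc d ℕ.* suc e) (suc b))))
  archimedean q (mkℚ (ℤ.+ 0) d _)    (ℚ.*<* (ℤ.+<+ ()))
  archimedean q (mkℚ -[1+ _ ] d _) (ℚ.*<* ())

  indicator : Bool → ℚ
  indicator c = if c then 1ℚ else 0ℚ

  0≤indicator : ∀ c → 0ℚ ≤ indicator c
  0≤indicator true  = <⇒≤ 0<1
  0≤indicator false = ≤-refl

  indicator≤1 : ∀ c → indicator c ≤ 1ℚ
  indicator≤1 true  = ≤-refl
  indicator≤1 false = <⇒≤ 0<1

  step : ℕ → ℕ → ℚ
  step u l = indicator (u <ᵇ l)

  step-diff≥0 : ∀ {u v} l → u ℕ.≤ v → 0ℚ ≤ step u l - step v l
  step-diff≥0 {u} {v} l u≤v with u <ᵇ l | ℕ.<ᵇ-reflects-< u l | v <ᵇ l | ℕ.<ᵇ-reflects-< v l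
  ... | true  | ofʸ _ | true  | ofʸ _ = ≤-reflexive (sym (+-inverseʳ 1ℚ))
  ... | true  | ofʸ _ | false | ofⁿ _ = <⇒≤ 0<1
  ... | false | ofⁿ _ | false | ofⁿ _ = ≤-refl
  ... | false | ofⁿ u≮l | true  | ofʸ v<l = contradiction (ℕ.≤-<-trans u≤v v<l) u≮l

  step-diff≤0 : ∀ {u v} l → v ℕ.≤ u → step u l - step v l ≤ 0ℚ
  step-diff≤0 {u} {v} l v≤u with u <ᵇ l | ℕ.<ᵇ-reflects-< u l | v <ᵇ l | ℕ.<ᵇ-reflects-< v l
  ... | true  | ofʸ _ | true  | ofʸ _ = ≤-reflexive (+-inverseʳ 1ℚ)
  ... | false | ofⁿ _ | true  | ofʸ _ = toWitness {a? = 0ℚ - 1ℚ ≤? 0ℚ} _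
  ... | false | ofⁿ _ | false | ofⁿ _ = ≤-refl
  ... | true  | ofʸ u<l | false | ofⁿ v≮l = contradiction (ℕ.≤-<-trans v≤u u<l) v≮l

  step-diff≤1 : ∀ u v l → step u l - step v l ≤ 1ℚ
  step-diff≤1 u v l with u <ᵇ l | ℕ.<ᵇ-reflects-< u l | v <ᵇ l | ℕ.<ᵇ-reflects-< v l
  ... | true  | ofʸ _ | true  | ofʸ _ = ≤-trans (≤-reflexive (+-inverseʳ 1ℚ)) (<⇒≤ 0<1)
  ... | true  | ofʸ _ | false | ofⁿ _ = ≤-refl
  ... | false | ofⁿ _ | true  | ofʸ _ = toWitness {a? = 0ℚ - 1ℚ ≤? 1ℚ} _
  ... | false | ofⁿ _ | false | ofⁿ _ = <⇒≤ 0<1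

  step-diff≡1 : ∀ {u v l} → u ℕ.< l → l ℕ.≤ v → step u l - step v l ≡ 1ℚ
  step-diff≡1 {u} {v} {l} u<l l≤v with u <ᵇ l | ℕ.<ᵇ-reflects-< u l | v <ᵇ l | ℕ.<ᵇ-reflects-< v l
  ... | true  | ofʸ _   | false | ofⁿ _   = refl
  ... | false | ofⁿ u≮l | _     | _       = contradiction u<l u≮l
  ... | _     | _       | true  | ofʸ v<l = contradiction (ℕ.<-≤-trans v<l l≤v) (ℕ.<-irrefl refl)

  step-diff≡0 : ∀ {u v} l → u ℕ.≤ v → ¬ (u ℕ.< l × l ℕ.≤ v) → step u l - step v l ≡ 0ℚ
  step-diff≡0 {u} {v} l u≤v ¬straddle with u <ᵇ l | ℕ.<ᵇ-reflects-< u l | v <ᵇ l | ℕ.<ᵇ-reflects-< v l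
  ... | true  | ofʸ _ | true  | ofʸ _ = +-inverseʳ 1ℚ
  ... | false | ofⁿ _ | false | ofⁿ _ = +-inverseʳ 0ℚ
  ... | true  | ofʸ u<l | false | ofⁿ v≮l = contradiction (u<l , ℕ.≮⇒≥ v≮l) ¬straddle
  ... | false | ofⁿ u≮l | true  | ofʸ v<l = contradiction (ℕ.≤-<-trans u≤v v<l) u≮l


module Linear where

  open import Data.Nat using (zero; suc)
  open import Data.Fin as Fin using (Fin; zero; suc; punchIn)
  import Data.Fin.Properties as Fin
  open import Data.Rational using (ℚ; 0ℚ; 1ℚ; _+_; _-_; _*_; -_; 1/_; ≢-nonZero; _≟_)
  open import Data.Rational.Properties
  open import Data.Rational.Solver using (module +-*-Solver)
  open import Data.Vec.Functional using (insertAt)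
  open import Data.Vec.Functional.Properties using (insertAt-lookup; insertAt-punchIn)
  open import Data.Product using (_,_)
  open import Function using (_∘_)
  open import Relation.Nullary using (¬_; ¬?; yes; no; contradiction)
  open import Relation.Binary.PropositionalEquality

  open +-*-Solver

  sumFin-cong : ∀ {k} {f g : Fin k → ℚ} → (∀ j → f j ≡ g j) → sumFin f ≡ sumFin g
  sumFin-cong {zero}  f≗g = refl
  sumFin-cong {suc k} f≗g = cong₂ _+_ (f≗g zero) (sumFin-cong (λ j → f≗g (suc j)))

  sumFin-zero : ∀ {k} {f : Fin k → ℚ} → (∀ j → f j ≡ 0ℚ) → sumFin f ≡ 0ℚ
  sumFin-zero {zero}  f≗0 = refl
  sumFin-zero {suc k} f≗0 = cong₂ _+_ (f≗0 zero) (sumFin-zero (λ j → f≗0 (suc j)))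

  sumFin-+ : ∀ {k} (f g : Fin k → ℚ) → sumFin (λ j → f j + g j) ≡ sumFin f + sumFin g
  sumFin-+ {zero}  f g = refl
  sumFin-+ {suc k} f g = trans (cong ((f zero + g zero) +_) (sumFin-+ (λ j → f (suc j)) (λ j → g (suc j))))
    (solve 4 (λ a b c d → (a :+ b) :+ (c :+ d) := (a :+ c) :+ (b :+ d)) refl (f zero) (g zero) _ _)

  sumFin-minus : ∀ {k} (f g : Fin k → ℚ) → sumFin (λ j → f j - g j) ≡ sumFin f - sumFin g
  sumFin-minus {zero}  f g = refl
  sumFin-minus {suc k} f g = trans (cong ((f zero - g zero) +_) (sumFin-minus (λ j → f (suc j)) (λ j → g (suc j))))
    (solve 4 (λ a b c d → (a :- b) :+ (c :- d) := (a :+ c) :- (b :+ d)) refl (f zero) (g zero) _ _)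

  sumFin-*-minus : ∀ {k} (c f g : Fin k → ℚ) →
                   sumFin (λ j → c j * (f j - g j)) ≡ sumFin (λ j → c j * f j) - sumFin (λ j → c j * g j)
  sumFin-*-minus c f g = trans (sumFin-cong (λ j → solve 3 (λ c a b → c :* (a :- b) := c :* a :- c :* b) refl (c j) (f j) (g j)))
                               (sumFin-minus (λ j → c j * f j) (λ j → c j * g j))

  sumFin-*ˡ : ∀ {k} a (f : Fin k → ℚ) → sumFin (λ j → a * f j) ≡ a * sumFin f
  sumFin-*ˡ {zero}  a f = sym (*-zeroʳ a)
  sumFin-*ˡ {suc k} a f = trans (cong ((a * f zero) +_) (sumFin-*ˡ a (λ j → f (suc j))))
    (sym (*-distribˡ-+ a (f zero) _))

  sumFin-punchIn : ∀ {k} (f : Fin (suc k) → ℚ) i → sumFin f ≡ f i + sumFin (λ j → f (punchIn i j))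
  sumFin-punchIn {k}     f zero    = refl
  sumFin-punchIn {suc k} f (suc i) = trans (cong (f zero +_) (sumFin-punchIn (λ j → f (suc j)) i))
    (solve 3 (λ a b c → a :+ (b :+ c) := b :+ (a :+ c)) refl (f zero) (f (suc i)) _)

  sumFin-indicator : ∀ {k} (c e : Fin k → ℚ) i → e i ≡ 1ℚ → (∀ j → j ≢ i → e j ≡ 0ℚ) →
                     sumFin (λ j → c j * e j) ≡ c i
  sumFin-indicator {suc k} c e i eᵢ≡1 e≡0 = begin
    sumFin (λ j → c j * e j)                                        ≡⟨ sumFin-punchIn (λ j → c j * e j) i ⟩
    c i * e i + sumFin (λ j → c (punchIn i j) * e (punchIn i j))     ≡⟨ cong₂ _+_ (cong (c i *_) eᵢ≡1) (sumFin-zero off-diagonal) ⟩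
    c i * 1ℚ + 0ℚ                                                   ≡⟨ trans (+-identityʳ _) (*-identityʳ (c i)) ⟩
    c i                                                             ∎
    where
    open ≡-Reasoning
    off-diagonal : ∀ j → c (punchIn i j) * e (punchIn i j) ≡ 0ℚ
    off-diagonal j = trans (cong (c (punchIn i j) *_) (e≡0 (punchIn i j) (Fin.punchInᵢ≢i i j))) (*-zeroʳ (c (punchIn i j)))


  record NontrivialRelation {n k} (vs : Fin k → Pt n) : Set where
    field
      coeff      : Fin k → ℚ
      vanishes   : ∀ t → sumFin (λ j → coeff j * vs j t) ≡ 0ℚ
      support    : Fin k
      support≢0  : coeff support ≢ 0ℚ

  relation⇒¬LinIndep : ∀ {n k} {vs : Fin k → Pt n} → NontrivialRelation vs → ¬ LinIndep vs
  relation⇒¬LinIndep r indep = support≢0 (indep coeff vanishes support)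
    where open NontrivialRelation r

  relation-dropHead : ∀ {n k} (vs : Fin k → Pt (suc n)) → (∀ j → vs j zero ≡ 0ℚ) →
                      NontrivialRelation (λ j t → vs j (suc t)) → NontrivialRelation vs
  relation-dropHead vs heads≡0 r = record { NontrivialRelation r; vanishes = vanishes′ }
    where
    open NontrivialRelation r
    vanishes′ : ∀ t → sumFin (λ j → coeff j * vs j t) ≡ 0ℚ
    vanishes′ zero    = sumFin-zero (λ j → trans (cong (coeff j *_) (heads≡0 j)) (*-zeroʳ (coeff j)))
    vanishes′ (suc t) = vanishes t

  relation-eliminate : ∀ {n k} (vs : Fin (suc k) → Pt n) i (r : Fin k → ℚ) →
                       NontrivialRelation (λ j t → vs (punchIn i j) t - r j * vs i t) →
                       NontrivialRelation vs
  relation-eliminate vs i r rel = record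
    { coeff = c ; vanishes = vanishes′ ; support = punchIn i support
    ; support≢0 = support≢0 ∘ trans (sym (insertAt-punchIn coeff i cᵢ support)) }
    where
    open NontrivialRelation rel
    cᵢ = - sumFin (λ j → coeff j * r j)
    c = insertAt coeff i cᵢ
    vanishes′ : ∀ t → sumFin (λ l → c l * vs l t) ≡ 0ℚ
    vanishes′ t = begin
      sumFin (λ l → c l * vs l t)
        ≡⟨ sumFin-punchIn (λ l → c l * vs l t) i ⟩
      c i * vs i t + sumFin (λ j → c (punchIn i j) * vs (punchIn i j) t)
        ≡⟨ cong₂ (λ a b → a * vs i t + b) (insertAt-lookup coeff i cᵢ)
                 (sumFin-cong (λ j → cong (_* vs (punchIn i j) t) (insertAt-punchIn coeff i cᵢ j))) ⟩
      cᵢ * vs i t + sumFin (λ j → coeff j * vs (punchIn i j) t)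
        ≡⟨ cong ((cᵢ * vs i t) +_) (sumFin-cong (λ j → split (coeff j) (vs (punchIn i j) t) (r j) (vs i t))) ⟩
      cᵢ * vs i t + sumFin (λ j → coeff j * (vs (punchIn i j) t - r j * vs i t) + vs i t * (coeff j * r j))
        ≡⟨ cong ((cᵢ * vs i t) +_)
             (trans (sumFin-+ (λ j → coeff j * (vs (punchIn i j) t - r j * vs i t)) (λ j → vs i t * (coeff j * r j)))
                    (cong₂ _+_ (vanishes t) (sumFin-*ˡ (vs i t) (λ j → coeff j * r j)))) ⟩
      cᵢ * vs i t + (0ℚ + vs i t * sumFin (λ j → coeff j * r j))
        ≡⟨ solve 2 (λ s v → (:- s) :* v :+ (con 0ℚ :+ v :* s) := con 0ℚ) refl (sumFin (λ j → coeff j * r j)) (vs i t) ⟩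
      0ℚ ∎
      where
      open ≡-Reasoning
      split : ∀ a p q u → a * p ≡ a * (p - q * u) + u * (a * q)
      split = solve 4 (λ a p q u → a :* p := a :* (p :- q :* u) :+ u :* (a :* q)) refl

  -- Gaussian elimination on the first coordinate.
  relation-of-k+1-vectors : ∀ k (vs : Fin (suc k) → Pt k) → NontrivialRelation vs
  relation-of-k+1-vectors zero vs = record
    { coeff = λ _ → 1ℚ ; vanishes = λ () ; support = zero ; support≢0 = λ () }
  relation-of-k+1-vectors (suc k) vs with Fin.any? (λ j → ¬? (vs j zero ≟ 0ℚ))
  ... | yes (i , headᵢ≢0) = relation-eliminate vs i r
          (relation-dropHead _ eliminated (relation-of-k+1-vectors k _))
    where
    instance _ = ≢-nonZero headᵢ≢0
    r : Fin (suc k) → ℚ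
    r j = vs (punchIn i j) zero * 1/ vs i zero
    eliminated : ∀ j → vs (punchIn i j) zero - r j * vs i zero ≡ 0ℚ
    eliminated j = trans (cong (_-_ (vs (punchIn i j) zero))
      (trans (*-assoc (vs (punchIn i j) zero) (1/ vs i zero) (vs i zero))
        (trans (cong (vs (punchIn i j) zero *_) (*-inverseˡ (vs i zero))) (*-identityʳ (vs (punchIn i j) zero)))))
      (+-inverseʳ (vs (punchIn i j) zero))
  ... | no  all-heads≡0 = relation-eliminate vs zero (λ _ → 0ℚ)
          (relation-dropHead _ eliminated (relation-of-k+1-vectors k _))
    where
    eliminated : ∀ j → vs (suc j) zero - 0ℚ * vs zero zero ≡ 0ℚ
    eliminated j with vs (suc j) zero ≟ 0ℚ
    ... | yes head≡0 = trans (cong₂ _-_ head≡0 (*-zeroˡ (vs zero zero))) (+-inverseʳ 0ℚ)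
    ... | no  head≢0 = contradiction (suc j , head≢0) all-heads≡0

  relation-of-factoring : ∀ {n k} (vs : Fin (suc k) → Pt n) (sample : Fin k → Fin n) (block : Fin n → Fin k) →
                          (∀ j t → vs j t ≡ vs j (sample (block t))) → NontrivialRelation vs
  relation-of-factoring {k = k} vs sample block factors = record
    { NontrivialRelation relation
    ; vanishes = λ t → trans (sumFin-cong (λ j → cong (coeff j *_) (factors j t))) (vanishes (block t)) }
    where
    relation = relation-of-k+1-vectors k (λ j b → vs j (sample b))
    open NontrivialRelation relation


module Combinatorics where

  open import Data.Nat as ℕ using (ℕ; zero; suc; _+_; _≤_; _<_; _<ᵇ_; _≡ᵇ_; s≤s; z≤n)
  import Data.Nat.Properties as ℕ
  open import Data.Fin as Fin using (Fin; zero; suc; toℕ)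
  open import Data.Fin.Permutation as Perm using (Permutation′; _⟨$⟩ʳ_; _⟨$⟩ˡ_)
  open import Data.Bool using (Bool; true; false; T; if_then_else_; _∧_)
  open import Data.Bool.Properties using (T-∧)
  open import Data.List using (List; []; _∷_; _++_; length; lookup; filter; replicate; scanl; concat; tabulate)
  import Data.List.Properties as List
  open import Data.List.Relation.Unary.Any as Any using (here; there)
  open import Data.List.Relation.Unary.Any.Properties using (any⁺; any⁻)
  open import Data.List.Relation.Unary.All as All using (All; []; _∷_)
  open import Data.List.Relation.Unary.Unique.Propositional using (Unique)
  open import Data.List.Relation.Unary.AllPairs using (_∷_)
  open import Data.List.Membership.Propositional using (_∈_)
  open import Data.List.Membership.Propositional.Properties using (∈-lookup)
  import Algebra.Properties.CommutativeMonoid.Sum ℕ.+-0-commutativeMonoid as Σℕ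
  open import Data.Product using (∃₂; _×_; _,_; proj₁; proj₂)
  open import Data.Sum using (_⊎_; inj₁; inj₂)
  open import Data.Empty using (⊥-elim)
  open import Function using (_∘_; _⇔_; mk⇔; Equivalence)
  open import Relation.Nullary using (¬_; yes; no; does; contradiction)
  open import Relation.Unary using (Decidable)
  open import Relation.Binary.PropositionalEquality
  open import Relation.Binary.Construct.Closure.Equivalence using (EqClosure)
  open import Relation.Binary.Construct.Closure.Symmetric using (fwd; bwd)
  open import Relation.Binary.Construct.Closure.ReflexiveTransitive using (ε; _◅_)

  lookup-injective : ∀ {A : Set} {xs : List A} → Unique xs → ∀ {i j} → lookup xs i ≡ lookup xs j → i ≡ j
  lookup-injective {xs = _ ∷ _} _          {zero}  {zero}  _  = refl
  lookup-injective {xs = _ ∷ _} (x∉ ∷ _)   {zero}  {suc j} eq = contradiction eq (All.lookup x∉ (∈-lookup j))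
  lookup-injective {xs = _ ∷ _} (x∉ ∷ _)   {suc i} {zero}  eq = contradiction (sym eq) (All.lookup x∉ (∈-lookup i))
  lookup-injective {xs = _ ∷ _} (_ ∷ uniq) {suc i} {suc j} eq = cong suc (lookup-injective uniq eq)

  countList≡length-filter : ∀ {A : Set} {P : A → Set} (p : A → Bool) (P? : Decidable P) (xs : List A) →
                            All (λ a → T (p a) ⇔ P a) xs → countList p xs ≡ length (filter P? xs)
  countList≡length-filter p P? []       []             = refl
  countList≡length-filter p P? (a ∷ xs) (pa⇔Pa ∷ agree) with p a | P? a
  ... | true  | yes _  = cong suc (countList≡length-filter p P? xs agree)
  ... | false | no  _  = countList≡length-filter p P? xs agree
  ... | true  | no ¬Pa = contradiction (Equivalence.to pa⇔Pa _) ¬Pa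
  ... | false | yes Pa = ⊥-elim (Equivalence.from pa⇔Pa Pa)


  EqClosure-crosses : ∀ {A : Set} {R : A → A → Set} {L : A → Set} → Decidable L → ∀ {a b} →
                      EqClosure R a b → L a → ¬ L b → ∃₂ λ p q → R p q × (L p × ¬ L q ⊎ L q × ¬ L p)
  EqClosure-crosses L? ε              La ¬Lb = contradiction La ¬Lb
  EqClosure-crosses L? (_◅_ {j = c} edge rest) La ¬Lb with L? c
  ... | yes Lc = EqClosure-crosses L? rest Lc ¬Lb
  ... | no ¬Lc with edge
  ...   | fwd r = _ , _ , r , inj₁ (La , ¬Lc)
  ...   | bwd r = _ , _ , r , inj₂ (La , ¬Lc)

  private
    indicator : Bool → ℕ
    indicator b = if b then 1 else 0

  countFin≡sum : ∀ {n} (p : Fin n → Bool) → countFin p ≡ Σℕ.sum (indicator ∘ p)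
  countFin≡sum {zero}  p = refl
  countFin≡sum {suc n} p = cong (indicator (p zero) +_) (countFin≡sum (p ∘ suc))

  countFin-permute : ∀ {n} (π : Permutation′ n) (p : Fin n → Bool) → countFin (p ∘ (π ⟨$⟩ˡ_)) ≡ countFin p
  countFin-permute π p = begin
    countFin (p ∘ (π ⟨$⟩ˡ_))                  ≡⟨ countFin≡sum (p ∘ (π ⟨$⟩ˡ_)) ⟩
    Σℕ.sum (indicator ∘ p ∘ (π ⟨$⟩ˡ_))        ≡⟨ Σℕ.sum-permute (indicator ∘ p ∘ (π ⟨$⟩ˡ_)) π ⟩
    Σℕ.sum (indicator ∘ p ∘ (π ⟨$⟩ˡ_) ∘ (π ⟨$⟩ʳ_)) ≡⟨ Σℕ.sum-cong-≗ (λ j → cong (indicator ∘ p) (Perm.inverseˡ π {j})) ⟩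
    Σℕ.sum (indicator ∘ p)                    ≡⟨ countFin≡sum p ⟨
    countFin p                                ∎
    where open ≡-Reasoning

  countFin-mono : ∀ {n} (p q : Fin n → Bool) → (∀ j → T (p j) → T (q j)) → countFin p ≤ countFin q
  countFin-mono {zero}  p q p⇒q = z≤n
  countFin-mono {suc n} p q p⇒q with p zero in eqp | q zero in eqq
  ... | true  | true  = s≤s (countFin-mono (p ∘ suc) (q ∘ suc) (p⇒q ∘ suc))
  ... | false | true  = ℕ.m≤n⇒m≤1+n (countFin-mono (p ∘ suc) (q ∘ suc) (p⇒q ∘ suc))
  ... | false | false = countFin-mono (p ∘ suc) (q ∘ suc) (p⇒q ∘ suc)
  ... | true  | false = contradiction (subst T eqq (p⇒q zero (subst T (sym eqp) _))) λ ()

  countFin-mono-< : ∀ {n} (p q : Fin n → Bool) → (∀ j → T (p j) → T (q j)) →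
                    ∀ j → ¬ T (p j) → T (q j) → countFin p < countFin q
  countFin-mono-< p q p⇒q zero ¬pj qj with p zero | q zero
  ... | true  | _     = contradiction _ ¬pj
  ... | false | false = contradiction qj λ ()
  ... | false | true  = s≤s (countFin-mono (p ∘ suc) (q ∘ suc) (p⇒q ∘ suc))
  countFin-mono-< p q p⇒q (suc j) ¬pj qj with p zero in eqp | q zero in eqq
  ... | true  | true  = s≤s (countFin-mono-< (p ∘ suc) (q ∘ suc) (p⇒q ∘ suc) j ¬pj qj)
  ... | false | true  = ℕ.m≤n⇒m≤1+n (countFin-mono-< (p ∘ suc) (q ∘ suc) (p⇒q ∘ suc) j ¬pj qj)
  ... | false | false = countFin-mono-< (p ∘ suc) (q ∘ suc) (p⇒q ∘ suc) j ¬pj qj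
  ... | true  | false = contradiction (subst T eqq (p⇒q zero (subst T (sym eqp) _))) λ ()

  countFin-<ᵇ : ∀ n i → i ≤ n → countFin {n} (λ j → toℕ j <ᵇ i) ≡ i
  countFin-<ᵇ n       zero    _       = countFin-none n
    where
    countFin-none : ∀ n → countFin {n} (λ j → toℕ j <ᵇ 0) ≡ 0
    countFin-none zero    = refl
    countFin-none (suc n) = countFin-none n
  countFin-<ᵇ (suc n) (suc i) (s≤s i≤n) = cong suc (countFin-<ᵇ n i i≤n)


  onDiagonalPoint⇔∈ : ∀ pts i → T (onDiagonalPoint pts i) ⇔ (i , i) ∈ pts
  onDiagonalPoint⇔∈ pts i = mk⇔ (Any.map diagonal⇒≡ ∘ any⁻ _ pts) (any⁺ _ ∘ Any.map ≡⇒diagonal)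
    where
    diagonal⇒≡ : ∀ {p} → T ((proj₁ p ≡ᵇ i) ∧ (proj₂ p ≡ᵇ i)) → (i , i) ≡ p
    diagonal⇒≡ {a , b} t with Equivalence.to T-∧ t
    ... | a≡ᵇi , b≡ᵇi = sym (cong₂ _,_ (ℕ.≡ᵇ⇒≡ a i a≡ᵇi) (ℕ.≡ᵇ⇒≡ b i b≡ᵇi))
    ≡⇒diagonal : ∀ {p} → (i , i) ≡ p → T ((proj₁ p ≡ᵇ i) ∧ (proj₂ p ≡ᵇ i))
    ≡⇒diagonal refl = Equivalence.from T-∧ (ℕ.≡⇒≡ᵇ i i refl , ℕ.≡⇒≡ᵇ i i refl)

  columns : ∀ {n} → (Fin n → ℕ) → List Step
  columns f = concat (tabulate (λ x → replicate (f x) north ++ east ∷ []))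

  dyckPath≡columns : ∀ {n} (w : Fin n → Fin n) → dyckPath w ≡ columns (multiplicity w)
  dyckPath≡columns w = cong concat (List.map-tabulate (λ x → x) (λ x → replicate (multiplicity w x) north ++ east ∷ []))

  heightBefore : ∀ {n} → (Fin n → ℕ) → Fin n → ℕ
  heightBefore f zero    = 0
  heightBefore f (suc k) = f zero + heightBefore (f ∘ suc) k

  private
    Diagonal : ℕ → ℕ × ℕ → List Step → Set
    Diagonal i p steps = (i , i) ∈ scanl move p steps

    ∉-left-of : ∀ {i a} b steps → i < a → ¬ Diagonal i (a , b) steps
    ∉-left-of b []              i<a (here refl) = ℕ.<-irrefl refl i<a
    ∉-left-of b (step ∷ steps)  i<a (here refl) = ℕ.<-irrefl refl i<a
    ∉-left-of b (north ∷ steps) i<a (there d)   = ∉-left-of (suc b) steps i<a d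
    ∉-left-of b (east ∷ steps)  i<a (there d)   = ∉-left-of b steps (ℕ.m<n⇒m<1+n i<a) d

    height-cong : ∀ {i a h h′} rest → h ≡ h′ → Diagonal i (a , h) rest → Diagonal i (a , h′) rest
    height-cong {i} {a} rest = subst (λ h → Diagonal i (a , h) rest)

    ∈-column⁻ : ∀ {i a} b m rest → Diagonal i (a , b) (replicate m north ++ east ∷ rest) →
                (a ≡ i × b ≤ i × i ≤ b + m) ⊎ Diagonal i (suc a , b + m) rest
    ∈-column⁻ b zero    rest (here refl) = inj₁ (refl , ℕ.≤-refl , ℕ.m≤m+n b 0)
    ∈-column⁻ b zero    rest (there d)   = inj₂ (height-cong rest (sym (ℕ.+-identityʳ b)) d)
    ∈-column⁻ b (suc m) rest (here refl) = inj₁ (refl , ℕ.≤-refl , ℕ.m≤m+n b (suc m))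
    ∈-column⁻ {i} b (suc m) rest (there d) with ∈-column⁻ (suc b) m rest d
    ... | inj₁ (a≡i , b<i , i≤) = inj₁ (a≡i , ℕ.<⇒≤ b<i , subst (i ≤_) (sym (ℕ.+-suc b m)) i≤)
    ... | inj₂ d′               = inj₂ (height-cong rest (sym (ℕ.+-suc b m)) d′)

    ∈-column⁺ : ∀ {i a} b m rest → a ≡ i → b ≤ i → i ≤ b + m → Diagonal i (a , b) (replicate m north ++ east ∷ rest)
    ∈-column⁺ {i} b m rest refl b≤i i≤b+m with b ℕ.≟ i
    ∈-column⁺ b zero    rest refl b≤i i≤b+m | yes refl = here refl
    ∈-column⁺ b (suc m) rest refl b≤i i≤b+m | yes refl = here refl
    ∈-column⁺ {i} b zero    rest refl b≤i i≤b+m | no b≢i =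
      contradiction (ℕ.≤-antisym b≤i (subst (i ≤_) (ℕ.+-identityʳ b) i≤b+m)) b≢i
    ∈-column⁺ {i} b (suc m) rest refl b≤i i≤b+m | no b≢i =
      there (∈-column⁺ (suc b) m rest refl (ℕ.≤∧≢⇒< b≤i b≢i) (subst (i ≤_) (ℕ.+-suc b m) i≤b+m))

    ∈-column⁺-later : ∀ {i a} b m rest → Diagonal i (suc a , b + m) rest →
                      Diagonal i (a , b) (replicate m north ++ east ∷ rest)
    ∈-column⁺-later b zero    rest d = there (height-cong rest (ℕ.+-identityʳ b) d)
    ∈-column⁺-later b (suc m) rest d = there (∈-column⁺-later (suc b) m rest (height-cong rest (ℕ.+-suc b m) d))

    columns-suc : ∀ {n} (f : Fin (suc n) → ℕ) → columns f ≡ replicate (f zero) north ++ east ∷ columns (f ∘ suc)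
    columns-suc f = List.++-assoc (replicate (f zero) north) (east ∷ []) (columns (f ∘ suc))

    first-column : ∀ {n i} (f : Fin (suc n) → ℕ) a b → Diagonal i (a , b) (columns f) →
                   Diagonal i (a , b) (replicate (f zero) north ++ east ∷ columns (f ∘ suc))
    first-column {i = i} f a b = subst (Diagonal i (a , b)) (columns-suc f)

    ∈-columns⁻ : ∀ {n i} (f : Fin n → ℕ) a b k → a + toℕ k ≡ i →
                 Diagonal i (a , b) (columns f) → b + heightBefore f k ≤ i
    ∈-columns⁻ {i = i} f a b zero a+0≡i d with ∈-column⁻ b (f zero) (columns (f ∘ suc)) (first-column f a b d)
    ... | inj₁ (_ , b≤i , _) = subst (_≤ i) (sym (ℕ.+-identityʳ b)) b≤i
    ... | inj₂ d′ = contradiction d′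
                      (∉-left-of (b + f zero) (columns (f ∘ suc)) (s≤s (ℕ.≤-reflexive (trans (sym a+0≡i) (ℕ.+-identityʳ a)))))
    ∈-columns⁻ {i = i} f a b (suc k) a+k≡i d with ∈-column⁻ b (f zero) (columns (f ∘ suc)) (first-column f a b d)
    ... | inj₁ (a≡i , _ , _) = contradiction (trans a+k≡i (sym a≡i)) (ℕ.m+1+n≢m a)
    ... | inj₂ d′ = subst (_≤ i) (ℕ.+-assoc b (f zero) (heightBefore (f ∘ suc) k))
                      (∈-columns⁻ (f ∘ suc) (suc a) (b + f zero) k (trans (sym (ℕ.+-suc a (toℕ k))) a+k≡i) d′)

    ∈-columns⁺ : ∀ {n i} (f : Fin n → ℕ) a b k → a + toℕ k ≡ i →
                 b + heightBefore f k ≤ i → i ≤ b + heightBefore f k + f k → Diagonal i (a , b) (columns f)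
    ∈-columns⁺ {i = i} f a b zero a+0≡i lo hi = subst (Diagonal i (a , b)) (sym (columns-suc f))
      (∈-column⁺ b (f zero) (columns (f ∘ suc)) (trans (sym (ℕ.+-identityʳ a)) a+0≡i)
                 (subst (_≤ i) (ℕ.+-identityʳ b) lo) (subst (λ h → i ≤ h + f zero) (ℕ.+-identityʳ b) hi))
    ∈-columns⁺ {i = i} f a b (suc k) a+k≡i lo hi = subst (Diagonal i (a , b)) (sym (columns-suc f))
      (∈-column⁺-later b (f zero) (columns (f ∘ suc))
        (∈-columns⁺ (f ∘ suc) (suc a) (b + f zero) k (trans (sym (ℕ.+-suc a (toℕ k))) a+k≡i)
          (subst (_≤ i) (sym (ℕ.+-assoc b (f zero) (heightBefore (f ∘ suc) k))) lo)
          (subst (λ h → i ≤ h + f (suc k)) (sym (ℕ.+-assoc b (f zero) (heightBefore (f ∘ suc) k))) hi)))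

  lettersBelow : ∀ {m n} → (Fin m → Fin n) → ℕ → ℕ
  lettersBelow w i = countFin (λ j → toℕ (w j) <ᵇ i)

  private
    heightBefore-sum : ∀ {m n} (g : Fin m → Fin n → ℕ) k →
                       heightBefore (λ x → Σℕ.sum (λ j → g j x)) k ≡ Σℕ.sum (λ j → heightBefore (g j) k)
    heightBefore-sum {m} g zero    = sym (Σℕ.sum-replicate-zero m)
    heightBefore-sum     g (suc k) = trans (cong (Σℕ.sum (λ j → g j zero) +_) (heightBefore-sum (λ j → g j ∘ suc) k))
                                           (sym (Σℕ.∑-distrib-+ (λ j → g j zero) (λ j → heightBefore (g j ∘ suc) k)))

    heightBefore-cong : ∀ {n} {f g : Fin n → ℕ} → (∀ x → f x ≡ g x) → ∀ k → heightBefore f k ≡ heightBefore g k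
    heightBefore-cong f≗g zero    = refl
    heightBefore-cong f≗g (suc k) = cong₂ _+_ (f≗g zero) (heightBefore-cong (f≗g ∘ suc) k)

    heightBefore-zero : ∀ {n} (k : Fin n) → heightBefore (λ _ → 0) k ≡ 0
    heightBefore-zero zero    = refl
    heightBefore-zero (suc k) = heightBefore-zero k

    heightBefore-point : ∀ {n} (y k : Fin n) → heightBefore (λ x → indicator (does (y Fin.≟ x))) k ≡ indicator (toℕ y <ᵇ toℕ k)
    heightBefore-point y       zero    = refl
    heightBefore-point zero    (suc k) = cong suc (heightBefore-zero k)
    heightBefore-point (suc y) (suc k) = heightBefore-point y k

    <ᵇ-suc : ∀ a b → indicator (a <ᵇ b) + indicator (a ≡ᵇ b) ≡ indicator (a <ᵇ suc b)
    <ᵇ-suc zero    zero    = refl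
    <ᵇ-suc zero    (suc b) = refl
    <ᵇ-suc (suc a) zero    = refl
    <ᵇ-suc (suc a) (suc b) = <ᵇ-suc a b

    does-≟≡≡ᵇ : ∀ {n} (a b : Fin n) → does (a Fin.≟ b) ≡ (toℕ a ≡ᵇ toℕ b)
    does-≟≡≡ᵇ zero    zero    = refl
    does-≟≡≡ᵇ zero    (suc b) = refl
    does-≟≡≡ᵇ (suc a) zero    = refl
    does-≟≡≡ᵇ (suc a) (suc b) = does-≟≡≡ᵇ a b

  heightBefore-multiplicity : ∀ {n} (w : Fin n → Fin n) k → heightBefore (multiplicity w) k ≡ lettersBelow w (toℕ k)
  heightBefore-multiplicity w k = begin
    heightBefore (multiplicity w) k
      ≡⟨ heightBefore-cong (λ x → countFin≡sum (λ j → does (w j Fin.≟ x))) k ⟩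
    heightBefore (λ x → Σℕ.sum (λ j → indicator (does (w j Fin.≟ x)))) k
      ≡⟨ heightBefore-sum (λ j x → indicator (does (w j Fin.≟ x))) k ⟩
    Σℕ.sum (λ j → heightBefore (λ x → indicator (does (w j Fin.≟ x))) k)
      ≡⟨ Σℕ.sum-cong-≗ (λ j → heightBefore-point (w j) k) ⟩
    Σℕ.sum (λ j → indicator (toℕ (w j) <ᵇ toℕ k))
      ≡⟨ countFin≡sum (λ j → toℕ (w j) <ᵇ toℕ k) ⟨
    lettersBelow w (toℕ k) ∎
    where open ≡-Reasoning

  heightAfter-multiplicity : ∀ {n} (w : Fin n → Fin n) k →
                             heightBefore (multiplicity w) k + multiplicity w k ≡ lettersBelow w (suc (toℕ k))
  heightAfter-multiplicity w k = begin
    heightBefore (multiplicity w) k + multiplicity w k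
      ≡⟨ cong₂ _+_ (trans (heightBefore-multiplicity w k) (countFin≡sum (λ j → toℕ (w j) <ᵇ toℕ k)))
                   (countFin≡sum (λ j → does (w j Fin.≟ k))) ⟩
    Σℕ.sum (λ j → indicator (toℕ (w j) <ᵇ toℕ k)) + Σℕ.sum (λ j → indicator (does (w j Fin.≟ k)))
      ≡⟨ Σℕ.∑-distrib-+ (λ j → indicator (toℕ (w j) <ᵇ toℕ k)) (λ j → indicator (does (w j Fin.≟ k))) ⟨
    Σℕ.sum (λ j → indicator (toℕ (w j) <ᵇ toℕ k) + indicator (does (w j Fin.≟ k)))
      ≡⟨ Σℕ.sum-cong-≗ (λ j → trans (cong (λ b → indicator (toℕ (w j) <ᵇ toℕ k) + indicator b) (does-≟≡≡ᵇ (w j) k))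
                                    (<ᵇ-suc (toℕ (w j)) (toℕ k))) ⟩
    Σℕ.sum (λ j → indicator (toℕ (w j) <ᵇ suc (toℕ k)))
      ≡⟨ countFin≡sum (λ j → toℕ (w j) <ᵇ suc (toℕ k)) ⟨
    lettersBelow w (suc (toℕ k)) ∎
    where open ≡-Reasoning

  private
    dyckDiagonal⇔ : ∀ {n} (w : Fin n → Fin n) i →
                    T (onDiagonalPoint (pathPoints (dyckPath w)) i) ⇔ Diagonal i (0 , 0) (columns (multiplicity w))
    dyckDiagonal⇔ w i = subst (λ steps → T (onDiagonalPoint (pathPoints (dyckPath w)) i) ⇔ Diagonal i (0 , 0) steps)
                              (dyckPath≡columns w) (onDiagonalPoint⇔∈ (pathPoints (dyckPath w)) i)

  return⇒lettersBelow≤ : ∀ {n} (w : Fin n → Fin n) k →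
                         T (onDiagonalPoint (pathPoints (dyckPath w)) (toℕ k)) → lettersBelow w (toℕ k) ≤ toℕ k
  return⇒lettersBelow≤ w k ret = subst (_≤ toℕ k) (heightBefore-multiplicity w k)
    (∈-columns⁻ (multiplicity w) 0 0 k refl (Equivalence.to (dyckDiagonal⇔ w (toℕ k)) ret))

  lettersBelow≤⇒return : ∀ {n} (w : Fin n → Fin n) k →
                         lettersBelow w (toℕ k) ≤ toℕ k → toℕ k ≤ lettersBelow w (suc (toℕ k)) →
                         T (onDiagonalPoint (pathPoints (dyckPath w)) (toℕ k))
  lettersBelow≤⇒return w k lo hi = Equivalence.from (dyckDiagonal⇔ w (toℕ k))
    (∈-columns⁺ (multiplicity w) 0 0 k refl (subst (_≤ toℕ k) (sym (heightBefore-multiplicity w k)) lo)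
      (subst (toℕ k ≤_) (sym (heightAfter-multiplicity w k)) hi))


module Regions where

  open Rational
  open Linear
  open Combinatorics using (lookup-injective)
  open import Data.Nat as ℕ using (ℕ; zero; suc; s≤s; z≤n)
  import Data.Nat.Properties as ℕ
  open import Data.Fin as Fin using (Fin; zero; suc; toℕ; fromℕ<; punchIn)
  import Data.Fin.Properties as Fin
  open import Data.Fin.Permutation as Perm using (Permutation′; _⟨$⟩ʳ_; _⟨$⟩ˡ_)
  open import Data.Bool as Bool using (Bool; true; false; _∧_; _∨_)
  open import Data.Bool.Properties using (∧-zeroʳ; ∧-identityʳ; ∨-identityʳ)
  open import Data.Rational as ℚ using (ℚ; 0ℚ; 1ℚ; ½; _+_; _-_; _*_; -_; _<_; _≤_; _⊓_; ∣_∣; nonNegative)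
  open import Data.Rational.Properties
  open import Data.Rational.Solver using (module +-*-Solver)
  open import Algebra.Properties.Group +-0-group using () renaming (⁻¹-involutive to neg-involutive)
  open import Data.List using (List; []; _∷_; length; lookup; filter; applyUpTo; concatMap; cartesianProduct; allFin)
  import Data.List.Relation.Unary.All as All
  open import Data.List.Relation.Unary.All.Properties using (all-filter)
  import Data.List.Relation.Unary.Any as Any
  open import Data.List.Relation.Unary.Any using (here; there)
  open import Data.List.Relation.Unary.Any.Properties using (lookup-index)
  import Data.List.Relation.Unary.Unique.Propositional.Properties as Unique
  open import Data.List.Membership.Propositional using (_∈_)
  open import Data.List.Membership.Propositional.Properties
    using (∈-lookup; ∈-filter⁺; ∈-filter⁻; ∈-applyUpTo⁺; ∈-applyUpTo⁻; ∈-concatMap⁺; ∈-cartesianProduct⁺; ∈-allFin)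
  import Data.List.Extrema
  open import Data.Product using (Σ; ∃; ∃₂; ∃-syntax; _×_; _,_; proj₁; proj₂)
  open import Data.Sum using (inj₁; inj₂)
  open import Function using (_∘_)
  open import Relation.Nullary using (¬_; ¬?; Dec; yes; no; does; contradiction)
  open import Relation.Nullary.Decidable using (_×-dec_; dec-true; dec-false; toWitness)
  open import Relation.Binary using (DecidableEquality; DecTotalOrder; tri<; tri≈; tri>)
  open import Relation.Binary.PropositionalEquality

  open +-*-Solver
  open Data.List.Extrema (DecTotalOrder.totalOrder ≤-decTotalOrder) using (argmax; argmax-all; f[xs]≤f[argmax])
  module ℕ-Extrema = Data.List.Extrema ℕ.≤-totalOrder

  lin : ∀ {n} → ShiHyp n → Pt n → ℚ
  lin (hyp i j _ _) v = v i - v j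

  hval-⊕ : ∀ {n} (H : ShiHyp n) y v → hval H (y ⊕ v) ≡ hval H y + lin H v
  hval-⊕ (hyp i j _ c) y v =
    solve 5 (λ a b c d e → (a :+ c) :- (b :+ d) :- e := (a :- b :- e) :+ (c :- d)) refl (y i) (y j) (v i) (v j) (indicator c)

  hval-cong : ∀ {n} (H : ShiHyp n) {y y′} → (∀ t → y t ≡ y′ t) → hval H y ≡ hval H y′
  hval-cong (hyp i j _ _) y≗y′ = cong₂ (λ a b → a - b - _) (y≗y′ i) (y≗y′ j)

  hyp-≡ : ∀ {n} {i j i′ j′ : Fin n} {i<j : i Fin.< j} {i′<j′ : i′ Fin.< j′} c → i ≡ i′ → j ≡ j′ →
          hyp i j i<j c ≡ hyp i′ j′ i′<j′ c
  hyp-≡ {i<j = i<j} {i′<j′} c refl refl = cong (λ p → hyp _ _ p c) (Fin.<-irrelevant i<j i′<j′)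

  _≟ₕ_ : ∀ {n} → DecidableEquality (ShiHyp n)
  hyp i j p c ≟ₕ hyp i′ j′ p′ c′ with i Fin.≟ i′ | j Fin.≟ j′ | c Bool.≟ c′
  ... | yes refl | yes refl | yes refl = yes (hyp-≡ c refl refl)
  ... | no i≢i′  | _        | _        = no (i≢i′ ∘ cong ShiHyp.i)
  ... | yes _    | no j≢j′  | _        = no (j≢j′ ∘ cong ShiHyp.j)
  ... | yes _    | yes _    | no c≢c′  = no (c≢c′ ∘ cong ShiHyp.const)

  private
    hyperplanesAt : ∀ {n} → Fin n × Fin n → List (ShiHyp n)
    hyperplanesAt (i , j) with i Fin.<? j
    ... | yes i<j = hyp i j i<j false ∷ hyp i j i<j true ∷ []
    ... | no  _   = []

    ∈-hyperplanesAt : ∀ {n} (H : ShiHyp n) → H ∈ hyperplanesAt (ShiHyp.i H , ShiHyp.j H)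
    ∈-hyperplanesAt (hyp i j i<j c) with i Fin.<? j
    ... | no  i≮j = contradiction i<j i≮j
    ... | yes i<j′ rewrite Fin.<-irrelevant i<j i<j′ with c
    ...   | false = here refl
    ...   | true  = there (here refl)

  hyperplanes : ∀ n → List (ShiHyp n)
  hyperplanes n = concatMap hyperplanesAt (cartesianProduct (allFin n) (allFin n))

  ∈-hyperplanes : ∀ {n} (H : ShiHyp n) → H ∈ hyperplanes n
  ∈-hyperplanes H = ∈-concatMap⁺ hyperplanesAt (Any.map (λ { refl → ∈-hyperplanesAt H })
                                           (∈-cartesianProduct⁺ (∈-allFin (ShiHyp.i H)) (∈-allFin (ShiHyp.j H))))

  InRegion-refl : ∀ {n} {x : Pt n} → Generic x → InRegion x x
  InRegion-refl {x = x} generic H with <-cmp (hval H x) 0ℚ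
  ... | tri< h<0 _ _ = inj₁ (h<0 , h<0)
  ... | tri≈ _ h≡0 _ = contradiction h≡0 (generic H)
  ... | tri> _ _ h>0 = inj₂ (h>0 , h>0)

  ∣lin∣≤ : ∀ {n} (H : ShiHyp n) {v r} → (∀ t → ∣ v t ∣ ≤ r) → ∣ lin H v ∣ ≤ r + r
  ∣lin∣≤ (hyp i j _ _) {v} ∣v∣≤r = ≤-trans (∣p-q∣≤∣p∣+∣q∣ (v i) (v j)) (+-mono-≤ (∣v∣≤r i) (∣v∣≤r j))

  sign-stable⁺ : ∀ {h Δ} → 0ℚ < h → ∣ Δ ∣ < h → 0ℚ < h + Δ
  sign-stable⁺ {h} {Δ} _ ∣Δ∣<h =
    subst (0ℚ <_) (cong (h +_) (neg-involutive Δ)) (p<q⇒0<q-p (≤-<-trans (-p≤∣p∣ Δ) ∣Δ∣<h))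

  sign-stable⁻ : ∀ {h Δ} → h < 0ℚ → ∣ Δ ∣ < - h → h + Δ < 0ℚ
  sign-stable⁻ {h} {Δ} _ ∣Δ∣<-h =
    subst (h + Δ <_) (+-inverseʳ h) (+-monoʳ-< h (≤-<-trans (p≤∣p∣ Δ) ∣Δ∣<-h))

  SameSide-stable : ∀ {n} (H : ShiHyp n) {x y v} → SameSide H x y → ∣ lin H v ∣ < ∣ hval H y ∣ → SameSide H x (y ⊕ v)
  SameSide-stable H {y = y} {v} (inj₁ (hx<0 , hy<0)) small =
    inj₁ (hx<0 , subst (_< 0ℚ) (sym (hval-⊕ H y v)) (sign-stable⁻ hy<0 (subst (∣ lin H v ∣ <_) (∣p∣≡-p hy<0) small)))
  SameSide-stable H {y = y} {v} (inj₂ (hx>0 , hy>0)) small =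
    inj₂ (hx>0 , subst (0ℚ <_) (sym (hval-⊕ H y v)) (sign-stable⁺ hy>0 (subst (∣ lin H v ∣ <_) (0≤p⇒∣p∣≡p (<⇒≤ hy>0)) small)))

  closure-weakSide : ∀ {n} {x y : Pt n} (H : ShiHyp n) → InClosure x y → hval H x < 0ℚ → hval H y ≤ 0ℚ
  closure-weakSide {x = x} {y} H y∈R̄ hx<0 = ≮⇒≥ λ hy>0 → above hy>0 (y∈R̄ ε (ε>0 hy>0))
    where
    ε : ℚ
    ε = hval H y * ½ * ½
    ε>0 : 0ℚ < hval H y → 0ℚ < ε
    ε>0 hy>0 = *-pos (*-pos hy>0 0<½) 0<½
    above : 0ℚ < hval H y → ¬ Σ (Pt _) (λ z → InRegion x z × (∀ t → ∣ z t - y t ∣ < ε))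
    above hy>0 (z , z∈R , close) with z∈R H
    ... | inj₂ (hx>0 , _) = <-asym hx<0 hx>0
    ... | inj₁ (_ , hz<0) = <-asym hz<0 (subst (0ℚ <_) hval≡ (sign-stable⁺ hy>0 small))
      where
      hval≡ : hval H y + lin H (z ⊖ y) ≡ hval H z
      hval≡ = trans (sym (hval-⊕ H y (z ⊖ y))) (hval-cong H (λ t → solve 2 (λ a b → a :+ (b :- a) := b) refl (y t) (z t)))
      small : ∣ lin H (z ⊖ y) ∣ < hval H y
      small = ≤-<-trans (∣lin∣≤ H (λ t → <⇒≤ (close t)))
                (subst (_< hval H y) (solve 1 (λ h → h :* con ½ := h :* con ½ :* con ½ :+ h :* con ½ :* con ½) refl (hval H y))
                                     (half< hy>0))

  iterate : ∀ {n} → Pt n → Pt n → ℕ → Pt n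
  iterate x v zero    = x
  iterate x v (suc m) = iterate x v m ⊕ v

  iterate-InRegion : ∀ {n} {x v : Pt n} → Generic x → Translations x v → ∀ m → InRegion x (iterate x v m)
  iterate-InRegion {x = x} generic v∈T zero    = InRegion-refl {x = x} generic
  iterate-InRegion {x = x} {v} generic v∈T (suc m) = v∈T (iterate x v m) (iterate-InRegion {x = x} {v} generic v∈T m)

  hval-iterate : ∀ {n} (H : ShiHyp n) x v m → hval H (iterate x v m) ≡ hval H x + m · lin H v
  hval-iterate H x v zero    = sym (+-identityʳ (hval H x))
  hval-iterate H x v (suc m) = begin
    hval H (iterate x v m ⊕ v)            ≡⟨ hval-⊕ H (iterate x v m) v ⟩
    hval H (iterate x v m) + lin H v      ≡⟨ cong (_+ lin H v) (hval-iterate H x v m) ⟩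
    hval H x + m · lin H v + lin H v      ≡⟨ solve 3 (λ h s l → h :+ s :+ l := h :+ (l :+ s)) refl (hval H x) (m · lin H v) (lin H v) ⟩
    hval H x + (lin H v + m · lin H v)    ∎
    where open ≡-Reasoning

  -- Otherwise some iterate x + m·v would lie across H.
  translation-below : ∀ {n} {x v : Pt n} → Generic x → Translations x v → ∀ H → hval H x < 0ℚ → lin H v ≤ 0ℚ
  translation-below {x = x} {v} generic v∈T H hx<0 = ≮⇒≥ λ l>0 → crosses (archimedean (- hval H x) (lin H v) l>0)
    where
    crosses : ¬ (∃[ m ] - hval H x < m · lin H v)
    crosses (m , far) with iterate-InRegion {x = x} {v} generic v∈T m H
    ... | inj₂ (hx>0 , _) = <-asym hx<0 hx>0
    ... | inj₁ (_ , h<0) = <-asym h<0 (subst (0ℚ <_) (sym (hval-iterate H x v m))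
                                        (subst (_< hval H x + m · lin H v) (+-inverseʳ (hval H x)) (+-monoʳ-< (hval H x) far)))

  translation-above : ∀ {n} {x v : Pt n} → Generic x → Translations x v → ∀ H → 0ℚ < hval H x → 0ℚ ≤ lin H v
  translation-above {x = x} {v} generic v∈T H hx>0 = ≮⇒≥ λ l<0 → crosses (archimedean (hval H x) (- lin H v) (neg-antimono-< l<0))
    where
    crosses : ¬ (∃[ m ] hval H x < m · (- lin H v))
    crosses (m , far) with iterate-InRegion {x = x} {v} generic v∈T m H
    ... | inj₁ (hx<0 , _) = <-asym hx<0 hx>0
    ... | inj₂ (_ , h>0) = <-asym h>0 (subst (_< 0ℚ) (sym (hval-iterate H x v m))
                                        (subst (hval H x + m · lin H v <_) (+-inverseʳ (hval H x))
                                          (+-monoʳ-< (hval H x) (subst (_< - hval H x) neg-m·neg (neg-antimono-< far)))))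
      where
      neg-m·neg : - (m · (- lin H v)) ≡ m · lin H v
      neg-m·neg = trans (cong -_ (·-neg m (lin H v))) (neg-involutive (m · lin H v))

  signCompatible⇒translation : ∀ {n} {x v : Pt n} →
    (∀ H → (hval H x < 0ℚ → lin H v ≤ 0ℚ) × (0ℚ < hval H x → 0ℚ ≤ lin H v)) → Translations x v
  signCompatible⇒translation {v = v} compatible y y∈R H with y∈R H
  ... | inj₁ (hx<0 , hy<0) = inj₁ (hx<0 , subst (_< 0ℚ) (sym (hval-⊕ H y v)) (+-neg-nonPos hy<0 (proj₁ (compatible H) hx<0)))
  ... | inj₂ (hx>0 , hy>0) = inj₂ (hx>0 , subst (0ℚ <_) (sym (hval-⊕ H y v)) (+-pos-nonNeg hy>0 (proj₂ (compatible H) hx>0)))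

  origin-below : ∀ {n} {i j : Fin n} (i<j : i Fin.< j) → hval (hyp i j i<j true) origin < 0ℚ
  origin-below _ = toWitness {a? = 0ℚ - 0ℚ - 1ℚ <? 0ℚ} _

  scale : ∀ {n} → ℚ → Pt n → Pt n
  scale a v t = a * v t

  unit : ∀ {n} → Fin n → Pt n
  unit i t = indicator (does (t Fin.≟ i))

  lin-scale : ∀ {n} (H : ShiHyp n) a v → lin H (scale a v) ≡ a * lin H v
  lin-scale (hyp i j _ _) a v = solve 3 (λ a p q → a :* p :- a :* q := a :* (p :- q)) refl a (v i) (v j)

  lin-⊖ : ∀ {n} (H : ShiHyp n) v w → lin H (v ⊖ w) ≡ lin H v - lin H w
  lin-⊖ (hyp i j _ _) v w = solve 4 (λ a b c d → (a :- c) :- (b :- d) := (a :- b) :- (c :- d)) refl (v i) (v j) (w i) (w j)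

  SameSide⇒0<∣hval∣ : ∀ {n} (H : ShiHyp n) {x y} → SameSide H x y → 0ℚ < ∣ hval H y ∣
  SameSide⇒0<∣hval∣ H (inj₁ (_ , hy<0)) = subst (0ℚ <_) (sym (∣p∣≡-p hy<0)) (neg-antimono-< hy<0)
  SameSide⇒0<∣hval∣ H (inj₂ (_ , hy>0)) = subst (0ℚ <_) (sym (0≤p⇒∣p∣≡p (<⇒≤ hy>0))) hy>0

  -- The vertices of the facet are y and y + r·d_k, where d_k runs through e_t (t ∉ {i, j})
  -- and e_i + e_j, a basis of the direction of H₀; each vertex is a limit of the points
  -- y + r·d_k - τ·e_i of the region.
  module _ {m : ℕ} (x y : Pt (suc m)) {i j : Fin (suc m)} (i<j : i Fin.< j)
           (x-below : hval (hyp i j i<j true) x < 0ℚ)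
           (y-on : OnHyp (hyp i j i<j true) y)
           (y-inside : ∀ H → H ≢ hyp i j i<j true → SameSide H x y) where

    private
      H₀ : ShiHyp (suc m)
      H₀ = hyp i j i<j true

      abstract
        margin : ∃[ μ ] 0ℚ < μ × (∀ H → H ≢ H₀ → μ ≤ ∣ hval H y ∣)
        margin with positive-lowerBound (λ H → ¬? (H ≟ₕ H₀)) (λ H → ∣ hval H y ∣) (hyperplanes (suc m))
                                        (λ H H≢H₀ → SameSide⇒0<∣hval∣ H {x} {y} (y-inside H H≢H₀))
        ... | μ , μ>0 , μ≤ = μ , μ>0 , λ H → μ≤ H (∈-hyperplanes H)

      μ : ℚ
      μ = proj₁ margin

      μ>0 : 0ℚ < μ
      μ>0 = proj₁ (proj₂ margin)

      r : ℚ
      r = μ * ½ * ½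

      r>0 : 0ℚ < r
      r>0 = *-pos (*-pos μ>0 0<½) 0<½

      r+r<μ : r + r < μ
      r+r<μ = subst (_< μ) (solve 1 (λ μ → μ :* con ½ := μ :* con ½ :* con ½ :+ μ :* con ½ :* con ½) refl μ) (half< μ>0)

      σ : Fin m → Fin (suc m)
      σ = punchIn j

      direction : Fin m → Fin (suc m) → Bool
      direction k t = does (t Fin.≟ σ k) ∨ (does (σ k Fin.≟ i) ∧ does (t Fin.≟ j))

      direction-i≡j : ∀ k → direction k i ≡ direction k j
      direction-i≡j k
        rewrite dec-false (i Fin.≟ j) (Fin.<⇒≢ i<j) | dec-true (j Fin.≟ j) refl
              | dec-false (j Fin.≟ σ k) (Fin.punchInᵢ≢i j k ∘ sym)
              | ∧-zeroʳ (does (σ k Fin.≟ i)) | ∨-identityʳ (does (i Fin.≟ σ k)) | ∧-identityʳ (does (σ k Fin.≟ i))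
        with σ k Fin.≟ i
      ... | yes σk≡i = dec-true (i Fin.≟ σ k) (sym σk≡i)
      ... | no  σk≢i = dec-false (i Fin.≟ σ k) (σk≢i ∘ sym)

      direction-σ : ∀ k k′ → direction k (σ k′) ≡ does (σ k′ Fin.≟ σ k)
      direction-σ k k′ rewrite dec-false (σ k′ Fin.≟ j) (Fin.punchInᵢ≢i j k′) | ∧-zeroʳ (does (σ k Fin.≟ i)) =
        ∨-identityʳ (does (σ k′ Fin.≟ σ k))

      shift : Fin (suc m) → Pt (suc m)
      shift zero    t = 0ℚ
      shift (suc k) t = r * indicator (direction k t)

      vertex : Fin (suc m) → Pt (suc m)
      vertex k = y ⊕ shift k

      lin-H₀-shift : ∀ k → lin H₀ (shift k) ≡ 0ℚ
      lin-H₀-shift zero    = +-inverseʳ 0ℚ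
      lin-H₀-shift (suc k) = trans (cong (λ b → r * indicator b - shift (suc k) j) (direction-i≡j k)) (+-inverseʳ (shift (suc k) j))

      0≤shift : ∀ k t → 0ℚ ≤ shift k t
      0≤shift zero    t = ≤-refl
      0≤shift (suc k) t = *-nonNeg (<⇒≤ r>0) (0≤indicator _)

      shift≤r : ∀ k t → shift k t ≤ r
      shift≤r zero    t = <⇒≤ r>0
      shift≤r (suc k) t = subst (r * indicator (direction k t) ≤_) (*-identityʳ r)
                            (*-monoˡ-≤-nonNeg r (indicator≤1 (direction k t)))
        where instance _ = nonNegative (<⇒≤ r>0)

      lin-H₀-unit : lin H₀ (unit i) ≡ 1ℚ
      lin-H₀-unit = cong₂ (λ a b → indicator a - indicator b) (dec-true (i Fin.≟ i) refl) (dec-false (j Fin.≟ i) (Fin.<⇒≢ i<j ∘ sym))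

      vertex-on : ∀ k → OnHyp H₀ (vertex k)
      vertex-on k = trans (hval-⊕ H₀ y (shift k)) (trans (cong₂ _+_ y-on (lin-H₀-shift k)) (+-identityʳ 0ℚ))

      vertex-closure : ∀ k → InClosure x (vertex k)
      vertex-closure k ε ε>0 = z , z∈R , close
        where
        τ : ℚ
        τ = (ε ⊓ μ) * ½ * ½
        τ>0 : 0ℚ < τ
        τ>0 = *-pos (*-pos (0<⊓ ε>0 μ>0) 0<½) 0<½
        τ<ε : τ < ε
        τ<ε = <-≤-trans (<-trans (half< (*-pos (0<⊓ ε>0 μ>0) 0<½)) (half< (0<⊓ ε>0 μ>0))) (p⊓q≤p ε μ)
        τ≤r : τ ≤ r
        τ≤r = *-monoʳ-≤-nonNeg ½ (*-monoʳ-≤-nonNeg ½ (p⊓q≤q ε μ))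
          where instance _ = nonNegative (<⇒≤ 0<½)
        τeᵢ push : Pt (suc m)
        τeᵢ = scale τ (unit i)
        push = shift k ⊖ τeᵢ
        z : Pt (suc m)
        z = y ⊕ push
        0≤τe : ∀ t → 0ℚ ≤ τ * unit i t
        0≤τe t = *-nonNeg (<⇒≤ τ>0) (0≤indicator _)
        τe≤τ : ∀ t → τ * unit i t ≤ τ
        τe≤τ t = subst (τ * unit i t ≤_) (*-identityʳ τ) (*-monoˡ-≤-nonNeg τ (indicator≤1 _))
          where instance _ = nonNegative (<⇒≤ τ>0)
        lin-push : ∀ H → ∣ lin H push ∣ < μ
        lin-push H = ≤-<-trans (∣lin∣≤ H (λ t → ∣p-q∣≤r (0≤shift k t) (shift≤r k t) (0≤τe t) (≤-trans (τe≤τ t) τ≤r))) r+r<μ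
        hval-H₀-z : hval H₀ z ≡ - τ
        hval-H₀-z = begin
          hval H₀ (y ⊕ push)                                      ≡⟨ hval-⊕ H₀ y push ⟩
          hval H₀ y + lin H₀ push                                 ≡⟨ cong (hval H₀ y +_) (lin-⊖ H₀ (shift k) τeᵢ) ⟩
          hval H₀ y + (lin H₀ (shift k) - lin H₀ τeᵢ)             ≡⟨ cong₂ (λ a b → a + (b - lin H₀ τeᵢ)) y-on (lin-H₀-shift k) ⟩
          0ℚ + (0ℚ - lin H₀ τeᵢ)                                  ≡⟨ cong (λ l → 0ℚ + (0ℚ - l))
                                                                       (trans (lin-scale H₀ τ (unit i)) (cong (τ *_) lin-H₀-unit)) ⟩
          0ℚ + (0ℚ - τ * 1ℚ)                                      ≡⟨ solve 1 (λ τ → con 0ℚ :+ (con 0ℚ :- τ :* con 1ℚ) := :- τ) refl τ ⟩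
          - τ                                                     ∎
          where open ≡-Reasoning
        z∈R : InRegion x z
        z∈R H with H ≟ₕ H₀
        ... | yes refl  = inj₁ (x-below , subst (_< 0ℚ) (sym hval-H₀-z) (neg-antimono-< τ>0))
        ... | no  H≢H₀  = SameSide-stable H {x} {y} {push} (y-inside H H≢H₀)
                            (<-≤-trans (lin-push H) (proj₂ (proj₂ margin) H H≢H₀))
        close : ∀ t → ∣ z t - vertex k t ∣ < ε
        close t = ≤-<-trans (≤-reflexive distance) (≤-<-trans (τe≤τ t) τ<ε)
          where
          distance : ∣ z t - vertex k t ∣ ≡ τ * unit i t
          distance = trans (cong ∣_∣ (solve 3 (λ y s e → (y :+ (s :- e)) :- (y :+ s) := :- e) refl (y t) (shift k t) (τ * unit i t)))
                           (trans (∣-p∣≡∣p∣ (τ * unit i t)) (0≤p⇒∣p∣≡p (0≤τe t)))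

      vertex-indep : LinIndep (λ k → vertex (suc k) ⊖ vertex zero)
      vertex-indep c vanishes k₀ = *-cancelʳ-≡0 (c k₀) (≢-sym (<⇒≢ r>0)) (begin
        c k₀ * r                                                 ≡⟨ sumFin-indicator (λ k → c k * r) e k₀ e-k₀ e-off ⟨
        sumFin (λ k → c k * r * e k)                             ≡⟨ sumFin-cong coordinate ⟩
        sumFin (λ k → c k * (vertex (suc k) ⊖ vertex zero) (σ k₀)) ≡⟨ vanishes (σ k₀) ⟩
        0ℚ                                                       ∎)
        where
        open ≡-Reasoning
        e : Fin m → ℚ
        e k = indicator (does (σ k₀ Fin.≟ σ k))
        e-k₀ : e k₀ ≡ 1ℚ
        e-k₀ = cong indicator (dec-true (σ k₀ Fin.≟ σ k₀) refl)
        e-off : ∀ k → k ≢ k₀ → e k ≡ 0ℚ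
        e-off k k≢k₀ = cong indicator (dec-false (σ k₀ Fin.≟ σ k) (k≢k₀ ∘ sym ∘ Fin.punchIn-injective j k₀ k))
        coordinate : ∀ k → c k * r * e k ≡ c k * (vertex (suc k) ⊖ vertex zero) (σ k₀)
        coordinate k = trans (cong (λ b → c k * r * indicator b) (sym (direction-σ k k₀)))
          (solve 4 (λ c r d y → c :* r :* d := c :* ((y :+ r :* d) :- (y :+ con 0ℚ))) refl
                   (c k) r (indicator (direction k (σ k₀))) (y (σ k₀)))

    witness⇒ceiling : Ceiling x (hyp i j i<j true)
    witness⇒ceiling = (λ ()) , (vertex , (λ k → vertex-closure k , vertex-on k) , vertex-indep) , inj₁ (x-below , origin-below i<j)

  module Sorted {n : ℕ} {x : Pt n} (generic : Generic x) (π : Permutation′ n) (decreasing : DecreasingOrder x π) where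

    x↓ : Fin n → ℚ
    x↓ p = x (π ⟨$⟩ʳ p)

    position : Fin n → ℕ
    position t = toℕ (π ⟨$⟩ˡ t)

    Tied : Fin n → Fin n → Set
    Tied p q = p Fin.< q × (π ⟨$⟩ʳ p) Fin.< (π ⟨$⟩ʳ q) × x↓ p - x↓ q < 1ℚ

    tied? : ∀ p q → Dec (Tied p q)
    tied? p q = p Fin.<? q ×-dec (π ⟨$⟩ʳ p) Fin.<? (π ⟨$⟩ʳ q) ×-dec (x↓ p - x↓ q <? 1ℚ)

    Straddles : ℕ → Fin n × Fin n → Set
    Straddles i (p , q) = Tied p q × toℕ p ℕ.< i × i ℕ.≤ toℕ q

    straddles? : ∀ i pq → Dec (Straddles i pq)
    straddles? i (p , q) = tied? p q ×-dec toℕ p ℕ.<? i ×-dec i ℕ.≤? toℕ q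

    Crossed : ℕ → Set
    Crossed i = ∃ (Straddles i)

    crossed? : ∀ i → Dec (Crossed i)
    crossed? i with Fin.any? (λ p → Fin.any? (λ q → straddles? i (p , q)))
    ... | yes (p , q , st) = yes ((p , q) , st)
    ... | no  none         = no λ ((p , q) , st) → none (p , q , st)

    x↓-injective : ∀ {p q} → x↓ p ≡ x↓ q → p ≡ q
    x↓-injective {p} {q} eq with Fin.<-cmp p q
    ... | tri< p<q _ _ = contradiction (sym eq) (<⇒≢ (decreasing p q p<q))
    ... | tri≈ _ p≡q _ = p≡q
    ... | tri> _ _ q<p = contradiction eq (<⇒≢ (decreasing q p q<p))

    hval-sorted : ∀ {a b} (a<b : a Fin.< b) c → hval (hyp a b a<b c) x ≡ x↓ (π ⟨$⟩ˡ a) - x↓ (π ⟨$⟩ˡ b) - indicator c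
    hval-sorted {a} {b} _ c = cong₂ (λ u v → x u - x v - indicator c) (sym (Perm.inverseʳ π)) (sym (Perm.inverseʳ π))

    hval-reversed : ∀ {a b} (a<b : a Fin.< b) c → (π ⟨$⟩ˡ b) Fin.< (π ⟨$⟩ˡ a) → hval (hyp a b a<b c) x < 0ℚ
    hval-reversed {a} {b} a<b c b<a = subst (_< 0ℚ) (sym (hval-sorted a<b c))
      (+-neg-nonPos (p<q⇒p-q<0 (decreasing _ _ b<a)) (neg-antimono-≤ (0≤indicator c)))

    hval-ordered : ∀ {a b} (a<b : a Fin.< b) → (π ⟨$⟩ˡ a) Fin.< (π ⟨$⟩ˡ b) → 0ℚ < hval (hyp a b a<b false) x
    hval-ordered a<b a<b′ = subst (0ℚ <_) (sym (trans (hval-sorted a<b false) (+-identityʳ _))) (p<q⇒0<q-p (decreasing _ _ a<b′))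

    hval-tied : ∀ {a b} (a<b : a Fin.< b) → Tied (π ⟨$⟩ˡ a) (π ⟨$⟩ˡ b) → hval (hyp a b a<b true) x < 0ℚ
    hval-tied a<b (_ , _ , d<1) = subst (_< 0ℚ) (sym (hval-sorted a<b true)) (p<q⇒p-q<0 d<1)

    hval-untied : ∀ {a b} (a<b : a Fin.< b) → (π ⟨$⟩ˡ a) Fin.< (π ⟨$⟩ˡ b) → ¬ Tied (π ⟨$⟩ˡ a) (π ⟨$⟩ˡ b) →
                  0ℚ < hval (hyp a b a<b true) x
    hval-untied {a} {b} a<b a<b′ untied = subst (0ℚ <_) (sym (hval-sorted a<b true)) (p<q⇒0<q-p 1<d)
      where
      d = x↓ (π ⟨$⟩ˡ a) - x↓ (π ⟨$⟩ˡ b)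
      1≤d : 1ℚ ≤ d
      1≤d = ≮⇒≥ λ d<1 → untied (a<b′ , subst₂ Fin._<_ (sym (Perm.inverseʳ π)) (sym (Perm.inverseʳ π)) a<b , d<1)
      1<d : 1ℚ < d
      1<d with <-cmp 1ℚ d
      ... | tri< 1<d _ _ = 1<d
      ... | tri≈ _ 1≡d _ = contradiction (trans (hval-sorted a<b true) (trans (cong (_- 1ℚ) (sym 1≡d)) (+-inverseʳ 1ℚ)))
                                         (generic (hyp a b a<b true))
      ... | tri> _ _ d<1 = contradiction (≤-<-trans 1≤d d<1) (<-irrefl refl)

    tied-below : ∀ {p q} (tied : Tied p q) → hval (hyp (π ⟨$⟩ʳ p) (π ⟨$⟩ʳ q) (proj₁ (proj₂ tied)) true) x < 0ℚ
    tied-below {p} {q} tied@(_ , πp<πq , _) =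
      hval-tied πp<πq (subst₂ Tied (sym (Perm.inverseˡ π)) (sym (Perm.inverseˡ π)) tied)

    below⇒tied : ∀ {a b} (a<b : a Fin.< b) c → (π ⟨$⟩ˡ a) Fin.< (π ⟨$⟩ˡ b) → hval (hyp a b a<b c) x < 0ℚ →
                 Tied (π ⟨$⟩ˡ a) (π ⟨$⟩ˡ b)
    below⇒tied a<b false a<b′ h<0 = contradiction (hval-ordered a<b a<b′) (<-asym h<0)
    below⇒tied a<b true  a<b′ h<0 with tied? _ _
    ... | yes tied  = tied
    ... | no  untied = contradiction (hval-untied a<b a<b′ untied) (<-asym h<0)

    private
      π-injective : ∀ {p q} → π ⟨$⟩ʳ p ≡ π ⟨$⟩ʳ q → p ≡ q
      π-injective {p} {q} πp≡πq = trans (sym (Perm.inverseˡ π)) (trans (cong (π ⟨$⟩ˡ_) πp≡πq) (Perm.inverseˡ π))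

      inverse-< : ∀ {p q} → p Fin.< q → (π ⟨$⟩ˡ (π ⟨$⟩ʳ p)) Fin.< (π ⟨$⟩ˡ (π ⟨$⟩ʳ q))
      inverse-< = subst₂ Fin._<_ (sym (Perm.inverseˡ π)) (sym (Perm.inverseˡ π))

    translation-antitone : ∀ {v} → Translations x v → ∀ {p q} → p Fin.< q → v (π ⟨$⟩ʳ q) ≤ v (π ⟨$⟩ʳ p)
    translation-antitone {v} v∈T {p} {q} p<q with Fin.<-cmp (π ⟨$⟩ʳ p) (π ⟨$⟩ʳ q)
    ... | tri< πp<πq _ _ =
      0≤q-p⇒p≤q (translation-above {x = x} {v} generic v∈T (hyp _ _ πp<πq false) (hval-ordered πp<πq (inverse-< p<q)))
    ... | tri≈ _ πp≡πq _ = contradiction (π-injective πp≡πq) (Fin.<⇒≢ p<q)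
    ... | tri> _ _ πq<πp =
      p-q≤0⇒p≤q (translation-below {x = x} {v} generic v∈T (hyp _ _ πq<πp false) (hval-reversed πq<πp false (inverse-< p<q)))

    translation-antitone≤ : ∀ {v} → Translations x v → ∀ {p q} → p Fin.≤ q → v (π ⟨$⟩ʳ q) ≤ v (π ⟨$⟩ʳ p)
    translation-antitone≤ v∈T {p} {q} p≤q with p Fin.≟ q
    ... | yes refl = ≤-refl
    ... | no  p≢q  = translation-antitone v∈T (Fin.≤∧≢⇒< p≤q p≢q)

    translation-tied : ∀ {v} → Translations x v → ∀ {p q} → Tied p q → v (π ⟨$⟩ʳ p) ≤ v (π ⟨$⟩ʳ q)
    translation-tied {v} v∈T {p} {q} tied@(_ , πp<πq , _) =
      p-q≤0⇒p≤q (translation-below {x = x} {v} generic v∈T (hyp _ _ πp<πq true) (tied-below tied))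

    -- A tied pair (p , q) straddling the cut between positions a and a + 1 forces
    -- v (π a) ≤ v (π p) ≤ v (π q) ≤ v (π (a + 1)).
    translation-crossed : ∀ {v} → Translations x v → ∀ {a} (a<n : a ℕ.< n) (1+a<n : suc a ℕ.< n) → Crossed (suc a) →
                          v (π ⟨$⟩ʳ fromℕ< 1+a<n) ≡ v (π ⟨$⟩ʳ fromℕ< a<n)
    translation-crossed v∈T {a} a<n 1+a<n ((p , q) , tied , p≤a , 1+a≤q) = ≤-antisym
      (translation-antitone v∈T (subst₂ ℕ._<_ (sym (Fin.toℕ-fromℕ< a<n)) (sym (Fin.toℕ-fromℕ< 1+a<n)) (ℕ.n<1+n a)))
      (≤-trans (translation-antitone≤ v∈T (subst (toℕ p ℕ.≤_) (sym (Fin.toℕ-fromℕ< a<n)) (ℕ.≤-pred p≤a)))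
        (≤-trans (translation-tied v∈T tied) (translation-antitone≤ v∈T (subst (ℕ._≤ toℕ q) (sym (Fin.toℕ-fromℕ< 1+a<n)) 1+a≤q))))

  module Dimension {m : ℕ} {x : Pt (suc m)} (generic : Generic x) (π : Permutation′ (suc m)) (decreasing : DecreasingOrder x π) where

    open Sorted {x = x} generic π decreasing

    openCuts : List ℕ
    openCuts = filter (λ i → ¬? (crossed? i)) (applyUpTo suc m)

    cut : Fin (length openCuts) → ℕ
    cut = lookup openCuts

    private
      inCuts : ∀ {i} → i ∈ openCuts → 1 ℕ.≤ i × i ℕ.< suc m
      inCuts i∈ with ∈-applyUpTo⁻ suc (proj₁ (∈-filter⁻ (λ i → ¬? (crossed? i)) {xs = applyUpTo suc m} i∈))
      ... | k , k<m , refl = s≤s z≤n , s≤s k<m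

    cut-bounds : ∀ k → 1 ℕ.≤ cut k × cut k ℕ.< suc m
    cut-bounds k = inCuts (∈-lookup {xs = openCuts} k)

    cut-open : ∀ k → ¬ Crossed (cut k)
    cut-open k = proj₂ (∈-filter⁻ (λ i → ¬? (crossed? i)) {xs = applyUpTo suc m} (∈-lookup {xs = openCuts} k))

    cut-injective : ∀ {k k′} → cut k ≡ cut k′ → k ≡ k′
    cut-injective = lookup-injective (Unique.filter⁺ (λ i → ¬? (crossed? i)) (Unique.applyUpTo⁺₁ suc m (λ i<j _ → ℕ.<⇒≢ (s≤s i<j))))

    cut-complete : ∀ i → 1 ℕ.≤ i → i ℕ.< suc m → ¬ Crossed i → ∃[ k ] i ≡ cut k
    cut-complete (suc i) _ (s≤s i<m) open′ = Any.index i∈ , lookup-index i∈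
      where i∈ = ∈-filter⁺ (λ i → ¬? (crossed? i)) (∈-applyUpTo⁺ suc i<m) open′

    segment : ℕ → Pt (suc m)
    segment l t = step (position t) l

    segment-translation : ∀ {l} → ¬ Crossed l → Translations x (segment l)
    segment-translation {l} open′ = signCompatible⇒translation {x = x} compatible
      where
      compatible : ∀ H → (hval H x < 0ℚ → lin H (segment l) ≤ 0ℚ) × (0ℚ < hval H x → 0ℚ ≤ lin H (segment l))
      compatible (hyp a b a<b c) with Fin.<-cmp (π ⟨$⟩ˡ a) (π ⟨$⟩ˡ b)
      ... | tri< a<b′ _ _ = (λ h<0 → ≤-reflexive (step-diff≡0 l (ℕ.<⇒≤ a<b′) λ (a<l , l≤b) →
                                        open′ ((π ⟨$⟩ˡ a , π ⟨$⟩ˡ b) , below⇒tied a<b c a<b′ h<0 , a<l , l≤b)))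
                          , (λ _ → step-diff≥0 l (ℕ.<⇒≤ a<b′))
      ... | tri≈ _ a≡b′ _ = contradiction (trans (sym (Perm.inverseʳ π)) (trans (cong (π ⟨$⟩ʳ_) a≡b′) (Perm.inverseʳ π))) (Fin.<⇒≢ a<b)
      ... | tri> _ _ b<a′ = (λ _ → step-diff≤0 l (ℕ.<⇒≤ b<a′)) , (λ h>0 → contradiction (hval-reversed a<b c b<a′) (<-asym h>0))

    basis : Fin (suc (length openCuts)) → Pt (suc m)
    basis zero    _ = 1ℚ
    basis (suc k)   = segment (cut k)

    basis-translation : ∀ k → Translations x (basis k)
    basis-translation zero    =
      signCompatible⇒translation {x = x} λ H → (λ _ → ≤-reflexive (lin-constant H)) , (λ _ → ≤-reflexive (sym (lin-constant H)))
      where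
      lin-constant : ∀ H → lin H (basis zero) ≡ 0ℚ
      lin-constant (hyp _ _ _ _) = +-inverseʳ 1ℚ
    basis-translation (suc k) = segment-translation (cut-open k)

    private
      coordinateAt : ∀ {a} → a ℕ.< suc m → Fin (suc m)
      coordinateAt a<n = π ⟨$⟩ʳ fromℕ< a<n

      position-coordinateAt : ∀ {a} (a<n : a ℕ.< suc m) → position (coordinateAt a<n) ≡ a
      position-coordinateAt a<n = trans (cong toℕ (Perm.inverseˡ π)) (Fin.toℕ-fromℕ< a<n)

      pred< : ∀ {l} → 1 ℕ.≤ l → ℕ.pred l ℕ.< l
      pred< (s≤s z≤n) = ℕ.≤-refl

      pred<⇒≤ : ∀ {l l′} → 1 ℕ.≤ l → ℕ.pred l ℕ.< l′ → l ℕ.≤ l′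
      pred<⇒≤ (s≤s z≤n) l-1<l′ = l-1<l′

    -- The segment coefficients are read off across the cut, at the positions l - 1 and l.
    basis-independent : LinIndep basis
    basis-independent c vanishes = all-zero
      where
      segment-coefficient : ∀ k → c (suc k) ≡ 0ℚ
      segment-coefficient k = begin
        c (suc k)                                                          ≡⟨ sumFin-indicator c jump (suc k) jump-here jump-elsewhere ⟨
        sumFin (λ j → c j * jump j)                                        ≡⟨ sumFin-*-minus c (λ j → basis j t₁) (λ j → basis j t₂) ⟩
        sumFin (λ j → c j * basis j t₁) - sumFin (λ j → c j * basis j t₂)  ≡⟨ cong₂ _-_ (vanishes t₁) (vanishes t₂) ⟩
        0ℚ - 0ℚ                                                            ≡⟨ +-inverseʳ 0ℚ ⟩
        0ℚ                                                                 ∎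
        where
        open ≡-Reasoning
        l = cut k
        1≤l = proj₁ (cut-bounds k)
        l<n = proj₂ (cut-bounds k)
        l-1<n : ℕ.pred l ℕ.< suc m
        l-1<n = ℕ.≤-<-trans ℕ.pred[n]≤n l<n
        t₁ t₂ : Fin (suc m)
        t₁ = coordinateAt l-1<n
        t₂ = coordinateAt l<n
        jump : Fin (suc (length openCuts)) → ℚ
        jump j = basis j t₁ - basis j t₂
        jump-segment : ∀ k′ → jump (suc k′) ≡ step (ℕ.pred l) (cut k′) - step l (cut k′)
        jump-segment k′ = cong₂ (λ u v → step u (cut k′) - step v (cut k′)) (position-coordinateAt l-1<n) (position-coordinateAt l<n)
        jump-here : jump (suc k) ≡ 1ℚ
        jump-here = trans (jump-segment k) (step-diff≡1 (pred< 1≤l) ℕ.≤-refl)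
        jump-elsewhere : ∀ j → j ≢ suc k → jump j ≡ 0ℚ
        jump-elsewhere zero    _       = +-inverseʳ 1ℚ
        jump-elsewhere (suc k′) k′≢k = trans (jump-segment k′) (step-diff≡0 (cut k′) ℕ.pred[n]≤n λ (l-1<l′ , l′≤l) →
          k′≢k (cong suc (cut-injective (ℕ.≤-antisym l′≤l (pred<⇒≤ 1≤l l-1<l′)))))
      all-zero : ∀ j → c j ≡ 0ℚ
      all-zero zero    = begin
        c zero                                                       ≡⟨ *-identityʳ (c zero) ⟨
        c zero * 1ℚ                                                  ≡⟨ +-identityʳ (c zero * 1ℚ) ⟨
        c zero * 1ℚ + 0ℚ                                             ≡⟨ cong (c zero * 1ℚ +_) (sumFin-zero segments) ⟨
        c zero * 1ℚ + sumFin (λ k → c (suc k) * basis (suc k) zero)  ≡⟨ vanishes zero ⟩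
        0ℚ                                                           ∎
        where
        open ≡-Reasoning
        segments : ∀ k → c (suc k) * basis (suc k) zero ≡ 0ℚ
        segments k = trans (cong (_* basis (suc k) zero) (segment-coefficient k)) (*-zeroˡ (basis (suc k) zero))
      all-zero (suc k) = segment-coefficient k

    representative : Fin (suc (length openCuts)) → Fin (suc m)
    representative zero    = π ⟨$⟩ʳ zero
    representative (suc k) = coordinateAt (proj₂ (cut-bounds k))

    -- Translations are constant between consecutive open cuts.
    represented : ∀ a (a<n : a ℕ.< suc m) → ∃[ k ] ∀ v → Translations x v → v (coordinateAt a<n) ≡ v (representative k)
    represented zero    a<n = zero , λ _ _ → refl
    represented (suc a) 1+a<n with crossed? (suc a)
    ... | yes crossed = let a<n = ℕ.<-trans (ℕ.n<1+n a) 1+a<n ; k , same = represented a a<n in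
                        k , λ v v∈T → trans (translation-crossed v∈T a<n 1+a<n crossed) (same v v∈T)
    ... | no  open′   = let k , a≡cut = cut-complete (suc a) (s≤s z≤n) 1+a<n open′ in
                        suc k , λ v _ → cong (v ∘ (π ⟨$⟩ʳ_)) (Fin.fromℕ<-cong _ _ a≡cut 1+a<n (proj₂ (cut-bounds k)))

    translations-dim : HasDim (Translations x) (suc (length openCuts))
    translations-dim = (basis , basis-translation , basis-independent) , too-many
      where
      too-many : ∀ (ws : Fin (suc (suc (length openCuts))) → Pt (suc m)) → (∀ j → Translations x (ws j)) → ¬ LinIndep ws
      too-many ws ws∈T = relation⇒¬LinIndep (relation-of-factoring ws representative block factors)
        where
        block : Fin (suc m) → Fin (suc (length openCuts))
        block t = proj₁ (represented (position t) (Fin.toℕ<n (π ⟨$⟩ˡ t)))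
        factors : ∀ j t → ws j t ≡ ws j (representative (block t))
        factors j t = trans (cong (ws j) (sym at-position)) (proj₂ (represented (position t) (Fin.toℕ<n (π ⟨$⟩ˡ t))) (ws j) (ws∈T j))
          where
          at-position : coordinateAt (Fin.toℕ<n (π ⟨$⟩ˡ t)) ≡ t
          at-position = trans (cong (π ⟨$⟩ʳ_) (Fin.fromℕ<-toℕ (π ⟨$⟩ˡ t) (Fin.toℕ<n (π ⟨$⟩ˡ t)))) (Perm.inverseʳ π)

  module Ceilings {m : ℕ} {x : Pt (suc m)} (generic : Generic x) (π : Permutation′ (suc m)) (decreasing : DecreasingOrder x π) where

    open Sorted {x = x} generic π decreasing

    -- A ceiling lies above x, and the facet's points y satisfy y_{π p} - y_{π q} = 1 while lying weakly
    -- on x's side of x_{π p} = x_{π q}; so q < p is impossible.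
    ceiling⇒tied : ∀ {p q} → CeilingRel x π p q → Tied p q
    ceiling⇒tied {p} {q} (πp<πq , _ , (facet , facet⊆ , _) , side) = p<q , πp<πq , gap<1 side
      where
      H₁ = hyp (π ⟨$⟩ʳ p) (π ⟨$⟩ʳ q) πp<πq true
      H₀ = hyp (π ⟨$⟩ʳ p) (π ⟨$⟩ʳ q) πp<πq false
      gap<1 : SameSide H₁ x origin → x↓ p - x↓ q < 1ℚ
      gap<1 (inj₁ (hx<0 , _)) = p-q<0⇒p<q hx<0
      gap<1 (inj₂ (_ , h₀>0)) = contradiction h₀>0 (<-asym (origin-below πp<πq))
      p<q : p Fin.< q
      p<q with Fin.<-cmp p q
      ... | tri< p<q _ _ = p<q
      ... | tri≈ _ refl _ = contradiction πp<πq (Fin.<-irrefl refl)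
      ... | tri> _ _ q<p = contradiction (closure-weakSide {x = x} {facet zero} H₀ (proj₁ (facet⊆ zero))
                                                           (p<q⇒p-q<0′ (decreasing q p q<p)))
                                         (<-irrefl refl ∘ <-≤-trans (subst (0ℚ <_) (facet-gap {facet zero} (proj₂ (facet⊆ zero))) 0<1))
        where
        p<q⇒p-q<0′ : x↓ p < x↓ q → hval H₀ x < 0ℚ
        p<q⇒p-q<0′ sp<sq = subst (_< 0ℚ) (sym (+-identityʳ (x↓ p - x↓ q))) (p<q⇒p-q<0 sp<sq)
        facet-gap : ∀ {y} → OnHyp H₁ y → 1ℚ ≡ hval H₀ y
        facet-gap {y} on = begin
          1ℚ                ≡⟨ +-identityˡ 1ℚ ⟨
          0ℚ + 1ℚ           ≡⟨ cong (_+ 1ℚ) on ⟨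
          hval H₁ y + 1ℚ    ≡⟨ solve 2 (λ a b → a :- b :- con 1ℚ :+ con 1ℚ := a :- b :- con 0ℚ) refl (y (π ⟨$⟩ʳ p)) (y (π ⟨$⟩ʳ q)) ⟩
          hval H₀ y         ∎
          where open ≡-Reasoning

    private
      gap : Fin (suc m) × Fin (suc m) → ℚ
      gap (p , q) = x↓ p - x↓ q

      pairs : List (Fin (suc m) × Fin (suc m))
      pairs = cartesianProduct (allFin (suc m)) (allFin (suc m))

      ∈-pairs : ∀ u → u ∈ pairs
      ∈-pairs (p , q) = ∈-cartesianProduct⁺ (∈-allFin p) (∈-allFin q)

    -- Among the tied pairs straddling the cut i, take one of largest gap and, among those,
    -- of leftmost start (a , b).  Then y = x + T·[position < i] + t·[position ≤ a], with t small and
    -- T = 1 - gap (a , b) - t, lies on the hyperplane of (a , b) and strictly inside every other wall.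
    module Crossing (i : ℕ) (u₀ : Fin (suc m) × Fin (suc m)) (u₀-straddles : Straddles i u₀) where

      straddling : List (Fin (suc m) × Fin (suc m))
      straddling = filter (straddles? i) pairs

      abstract
        widest : Fin (suc m) × Fin (suc m)
        widest = argmax gap u₀ straddling

        widest-straddles : Straddles i widest
        widest-straddles = argmax-all gap u₀-straddles (all-filter (straddles? i) pairs)

        widest-max : ∀ u → Straddles i u → gap u ≤ gap widest
        widest-max u st = All.lookup (f[xs]≤f[argmax] {f = gap} u₀ straddling) (∈-filter⁺ (straddles? i) (∈-pairs u) st)

      Widest : Fin (suc m) × Fin (suc m) → Set
      Widest u = Straddles i u × gap u ≡ gap widest

      widest? : ∀ u → Dec (Widest u)
      widest? u = straddles? i u ×-dec (gap u ℚ.≟ gap widest)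

      abstract
        chosen : Fin (suc m) × Fin (suc m)
        chosen = ℕ-Extrema.argmin (toℕ ∘ proj₁) widest (filter widest? straddling)

        chosen-widest : Widest chosen
        chosen-widest = ℕ-Extrema.argmin-all (toℕ ∘ proj₁) (widest-straddles , refl) (all-filter widest? straddling)

        chosen-leftmost : ∀ u → Widest u → toℕ (proj₁ chosen) ℕ.≤ toℕ (proj₁ u)
        chosen-leftmost u w = All.lookup (ℕ-Extrema.f[argmin]≤f[xs] {f = toℕ ∘ proj₁} widest (filter widest? straddling))
                                         (∈-filter⁺ widest? (∈-filter⁺ (straddles? i) (∈-pairs u) (proj₁ w)) w)

      a b : Fin (suc m)
      a = proj₁ chosen
      b = proj₂ chosen

      ab-tied : Tied a b
      ab-tied = proj₁ (proj₁ chosen-widest)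

      a<i : toℕ a ℕ.< i
      a<i = proj₁ (proj₂ (proj₁ chosen-widest))

      i≤b : i ℕ.≤ toℕ b
      i≤b = proj₂ (proj₂ (proj₁ chosen-widest))

      dmax : ℚ
      dmax = gap widest

      abstract
        slack : ∃[ μ ] 0ℚ < μ × (∀ u → u ∈ pairs → Tied (proj₁ u) (proj₂ u) → μ ≤ 1ℚ - gap u)
        slack = positive-lowerBound (λ (p , q) → tied? p q) (λ u → 1ℚ - gap u) pairs
                                    (λ (p , q) (_ , _ , gap<1) → p<q⇒0<q-p gap<1)

      t : ℚ
      t = proj₁ slack * ½

      t>0 : 0ℚ < t
      t>0 = *-pos (proj₁ (proj₂ slack)) 0<½

      t<1-gap : ∀ {p q} → Tied p q → t < 1ℚ - gap (p , q)
      t<1-gap {p} {q} tied = <-≤-trans (half< (proj₁ (proj₂ slack))) (proj₂ (proj₂ slack) (p , q) (∈-pairs (p , q)) tied)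

      T : ℚ
      T = 1ℚ - dmax - t

      T>0 : 0ℚ < T
      T>0 = p<q⇒0<q-p (subst (λ d → t < 1ℚ - d) (proj₂ chosen-widest) (t<1-gap ab-tied))

      Δ : Fin (suc m) → Fin (suc m) → ℚ
      Δ p q = T * (step (toℕ p) i - step (toℕ q) i) + t * (step (toℕ p) (suc (toℕ a)) - step (toℕ q) (suc (toℕ a)))

      w : Pt (suc m)
      w c = T * step (position c) i + t * step (position c) (suc (toℕ a))

      y : Pt (suc m)
      y = x ⊕ w

      hval-y : ∀ {a′ b′} (a′<b′ : a′ Fin.< b′) c → hval (hyp a′ b′ a′<b′ c) y ≡ hval (hyp a′ b′ a′<b′ c) x + Δ (π ⟨$⟩ˡ a′) (π ⟨$⟩ˡ b′)
      hval-y {a′} {b′} a′<b′ c = trans (hval-⊕ (hyp a′ b′ a′<b′ c) x w)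
        (cong (hval (hyp a′ b′ a′<b′ c) x +_)
          (solve 6 (λ T t p q p′ q′ → (T :* p :+ t :* p′) :- (T :* q :+ t :* q′) := T :* (p :- q) :+ t :* (p′ :- q′)) refl
            T t (step (position a′) i) (step (position b′) i) (step (position a′) (suc (toℕ a))) (step (position b′) (suc (toℕ a)))))

      Δ-nonNeg : ∀ {p q} → toℕ p ℕ.≤ toℕ q → 0ℚ ≤ Δ p q
      Δ-nonNeg p≤q = nonNeg+nonNeg (*-nonNeg (<⇒≤ T>0) (step-diff≥0 i p≤q)) (*-nonNeg (<⇒≤ t>0) (step-diff≥0 (suc (toℕ a)) p≤q))

      Δ-nonPos : ∀ {p q} → toℕ q ℕ.≤ toℕ p → Δ p q ≤ 0ℚ
      Δ-nonPos q≤p = nonPos+nonPos (*-nonPos (<⇒≤ T>0) (step-diff≤0 i q≤p)) (*-nonPos (<⇒≤ t>0) (step-diff≤0 (suc (toℕ a)) q≤p))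

      Δ-chosen : Δ a b ≡ T + t
      Δ-chosen = trans (cong₂ (λ u v → T * u + t * v) (step-diff≡1 a<i i≤b) (step-diff≡1 (ℕ.n<1+n (toℕ a)) (proj₁ ab-tied)))
                       (cong₂ _+_ (*-identityʳ T) (*-identityʳ t))

      Δ≤T+t : ∀ p q → Δ p q ≤ T + t
      Δ≤T+t p q = +-mono-≤ (*-≤-self (<⇒≤ T>0) (step-diff≤1 (toℕ p) (toℕ q) i))
                           (*-≤-self (<⇒≤ t>0) (step-diff≤1 (toℕ p) (toℕ q) (suc (toℕ a))))

      private
        A₁ A₂ : Fin (suc m) → Fin (suc m) → ℚ
        A₁ p q = step (toℕ p) i - step (toℕ q) i
        A₂ p q = step (toℕ p) (suc (toℕ a)) - step (toℕ q) (suc (toℕ a))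

      below-if-not-straddling : ∀ {p q} → Tied p q → ¬ Straddles i (p , q) → gap (p , q) - 1ℚ + Δ p q < 0ℚ
      below-if-not-straddling {p} {q} tied@(p<q , _) ¬straddles = begin-strict
        gap (p , q) - 1ℚ + (T * A₁ p q + t * A₂ p q)  ≡⟨ cong (λ u → gap (p , q) - 1ℚ + (T * u + t * A₂ p q)) A₁≡0 ⟩
        gap (p , q) - 1ℚ + (T * 0ℚ + t * A₂ p q)      ≡⟨ cong (λ u → gap (p , q) - 1ℚ + (u + t * A₂ p q)) (*-zeroʳ T) ⟩
        gap (p , q) - 1ℚ + (0ℚ + t * A₂ p q)          ≤⟨ +-monoʳ-≤ (gap (p , q) - 1ℚ) (+-monoʳ-≤ 0ℚ tA₂≤t) ⟩
        gap (p , q) - 1ℚ + (0ℚ + t)                   <⟨ +-monoʳ-< (gap (p , q) - 1ℚ) (subst (_< 1ℚ - gap (p , q)) (sym (+-identityˡ t)) (t<1-gap tied)) ⟩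
        gap (p , q) - 1ℚ + (1ℚ - gap (p , q))         ≡⟨ solve 1 (λ g → g :- con 1ℚ :+ (con 1ℚ :- g) := con 0ℚ) refl (gap (p , q)) ⟩
        0ℚ                                            ∎
        where
        open ≤-Reasoning
        A₁≡0 : A₁ p q ≡ 0ℚ
        A₁≡0 = step-diff≡0 i (ℕ.<⇒≤ p<q) λ (p<i , i≤q) → ¬straddles (tied , p<i , i≤q)
        tA₂≤t : t * A₂ p q ≤ t
        tA₂≤t = *-≤-self (<⇒≤ t>0) (step-diff≤1 (toℕ p) (toℕ q) (suc (toℕ a)))

      below-if-narrower : ∀ p q → gap (p , q) < dmax → gap (p , q) - 1ℚ + Δ p q < 0ℚ
      below-if-narrower p q narrower = begin-strict
        gap (p , q) - 1ℚ + Δ p q    ≤⟨ +-monoʳ-≤ (gap (p , q) - 1ℚ) (Δ≤T+t p q) ⟩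
        gap (p , q) - 1ℚ + (T + t)  ≡⟨ solve 3 (λ g d t → g :- con 1ℚ :+ ((con 1ℚ :- d :- t) :+ t) := g :- d) refl
                                              (gap (p , q)) dmax t ⟩
        gap (p , q) - dmax          <⟨ p<q⇒p-q<0 narrower ⟩
        0ℚ                          ∎
        where open ≤-Reasoning

      below-if-right-of-a : ∀ {p q} → Straddles i (p , q) → gap (p , q) ≡ dmax → toℕ a ℕ.< toℕ p →
                            gap (p , q) - 1ℚ + Δ p q < 0ℚ
      below-if-right-of-a {p} {q} ((p<q , _) , p<i , i≤q) as-wide a<p = begin-strict
        gap (p , q) - 1ℚ + (T * A₁ p q + t * A₂ p q) ≡⟨ cong₂ (λ u v → gap (p , q) - 1ℚ + (T * u + t * v)) (step-diff≡1 p<i i≤q) A₂≡0 ⟩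
        gap (p , q) - 1ℚ + (T * 1ℚ + t * 0ℚ)        ≡⟨ cong (λ g → g - 1ℚ + (T * 1ℚ + t * 0ℚ)) as-wide ⟩
        dmax - 1ℚ + (T * 1ℚ + t * 0ℚ)               ≡⟨ solve 2 (λ d t → d :- con 1ℚ :+ ((con 1ℚ :- d :- t) :* con 1ℚ :+ t :* con 0ℚ) := :- t)
                                                             refl dmax t ⟩
        - t                                         <⟨ neg-antimono-< t>0 ⟩
        0ℚ                                          ∎
        where
        open ≤-Reasoning
        A₂≡0 : A₂ p q ≡ 0ℚ
        A₂≡0 = step-diff≡0 (suc (toℕ a)) (ℕ.<⇒≤ p<q) λ (p≤a , _) → ℕ.<-irrefl refl (ℕ.<-≤-trans a<p (ℕ.≤-pred p≤a))

      widest-from-a : ∀ {p q} → gap (p , q) ≡ dmax → toℕ a ≡ toℕ p → (p , q) ≡ (a , b)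
      widest-from-a {p} {q} as-wide a≡p = cong₂ _,_ p≡a (x↓-injective (begin
        x↓ q                  ≡⟨ solve 2 (λ u v → v := u :- (u :- v)) refl (x↓ p) (x↓ q) ⟩
        x↓ p - gap (p , q)    ≡⟨ cong₂ (λ u v → x↓ u - v) p≡a (trans as-wide (sym (proj₂ chosen-widest))) ⟩
        x↓ a - gap (a , b)    ≡⟨ solve 2 (λ u v → u :- (u :- v) := v) refl (x↓ a) (x↓ b) ⟩
        x↓ b                  ∎))
        where
        open ≡-Reasoning
        p≡a : p ≡ a
        p≡a = Fin.toℕ-injective (sym a≡p)

      y-below-tied : ∀ {p q} → Tied p q → (p , q) ≢ (a , b) → gap (p , q) - 1ℚ + Δ p q < 0ℚ
      y-below-tied {p} {q} tied pq≢ab with straddles? i (p , q)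
      ... | no ¬straddles = below-if-not-straddling tied ¬straddles
      ... | yes straddles with <-cmp (gap (p , q)) dmax
      ...   | tri< narrower _ _ = below-if-narrower p q narrower
      ...   | tri> _ _ wider    = contradiction (widest-max (p , q) straddles) (<⇒≱ wider)
      ...   | tri≈ _ as-wide _ with toℕ a ℕ.≟ toℕ p
      ...     | yes a≡p = contradiction (widest-from-a as-wide a≡p) pq≢ab
      ...     | no  a≢p = below-if-right-of-a straddles as-wide (ℕ.≤∧≢⇒< (chosen-leftmost (p , q) (straddles , as-wide)) a≢p)

      H-chosen : ShiHyp (suc m)
      H-chosen = hyp (π ⟨$⟩ʳ a) (π ⟨$⟩ʳ b) (proj₁ (proj₂ ab-tied)) true

      y-on : OnHyp H-chosen y
      y-on = begin
        hval H-chosen y                                    ≡⟨ hval-y (proj₁ (proj₂ ab-tied)) true ⟩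
        hval H-chosen x + Δ (π⁻¹π a) (π⁻¹π b)              ≡⟨ cong (_+ Δ (π⁻¹π a) (π⁻¹π b)) (hval-sorted (proj₁ (proj₂ ab-tied)) true) ⟩
        gap (π⁻¹π a , π⁻¹π b) - 1ℚ + Δ (π⁻¹π a) (π⁻¹π b)  ≡⟨ cong₂ (λ u v → gap (u , v) - 1ℚ + Δ u v) (Perm.inverseˡ π) (Perm.inverseˡ π) ⟩
        gap (a , b) - 1ℚ + Δ a b                           ≡⟨ cong₂ (λ g d → g - 1ℚ + d) (proj₂ chosen-widest) Δ-chosen ⟩
        dmax - 1ℚ + (T + t)                                ≡⟨ solve 2 (λ d t → d :- con 1ℚ :+ ((con 1ℚ :- d :- t) :+ t) := con 0ℚ) refl dmax t ⟩
        0ℚ                                                 ∎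
        where
        open ≡-Reasoning
        π⁻¹π : Fin (suc m) → Fin (suc m)
        π⁻¹π c = π ⟨$⟩ˡ (π ⟨$⟩ʳ c)

      y-inside : ∀ H → H ≢ H-chosen → SameSide H x y
      y-inside (hyp a′ b′ a′<b′ c) H≢ with Fin.<-cmp (π ⟨$⟩ˡ a′) (π ⟨$⟩ˡ b′)
      ... | tri> _ _ q<p = inj₁ (hval-reversed a′<b′ c q<p ,
                                 subst (_< 0ℚ) (sym (hval-y a′<b′ c)) (+-neg-nonPos (hval-reversed a′<b′ c q<p) (Δ-nonPos (ℕ.<⇒≤ q<p))))
      ... | tri≈ _ p≡q _ = contradiction (trans (sym (Perm.inverseʳ π)) (trans (cong (π ⟨$⟩ʳ_) p≡q) (Perm.inverseʳ π))) (Fin.<⇒≢ a′<b′)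
      ... | tri< p<q _ _ with c | tied? (π ⟨$⟩ˡ a′) (π ⟨$⟩ˡ b′)
      ...   | false | _ = inj₂ (hval-ordered a′<b′ p<q ,
                                subst (0ℚ <_) (sym (hval-y a′<b′ false)) (+-pos-nonNeg (hval-ordered a′<b′ p<q) (Δ-nonNeg (ℕ.<⇒≤ p<q))))
      ...   | true | no untied = inj₂ (hval-untied a′<b′ p<q untied ,
                                subst (0ℚ <_) (sym (hval-y a′<b′ true))
                                      (+-pos-nonNeg (hval-untied a′<b′ p<q untied) (Δ-nonNeg (ℕ.<⇒≤ p<q))))
      ...   | true | yes tied = inj₁ (hval-tied a′<b′ tied ,
                                subst (_< 0ℚ) (sym (trans (hval-y a′<b′ true) (cong (_+ Δ (π ⟨$⟩ˡ a′) (π ⟨$⟩ˡ b′)) (hval-sorted a′<b′ true))))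
                                  (y-below-tied tied λ pq≡ab → H≢ (hyp-≡ true (moved (cong proj₁ pq≡ab)) (moved (cong proj₂ pq≡ab)))))
        where
        moved : ∀ {c d} → π ⟨$⟩ˡ c ≡ d → c ≡ π ⟨$⟩ʳ d
        moved eq = trans (sym (Perm.inverseʳ π)) (cong (π ⟨$⟩ʳ_) eq)

    abstract
      crossed⇒ceiling : ∀ {i} → Crossed i → ∃₂ λ p q → CeilingRel x π p q × toℕ p ℕ.< i × i ℕ.≤ toℕ q
      crossed⇒ceiling {i} (u₀ , u₀-straddles) = a , b ,
        (proj₁ (proj₂ ab-tied) , witness⇒ceiling x y (proj₁ (proj₂ ab-tied)) (tied-below ab-tied) y-on y-inside) , a<i , i≤b
        where open Crossing i u₀ u₀-straddles


module Returns {m : ℕ} {x : Pt (suc m)} (generic : Generic x) (π : Permutation′ (suc m)) (decreasing : DecreasingOrder x π)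
               (w : Fin (suc m) → Fin (suc m)) (parking : ShiParking x π w) where

  open Combinatorics
  open Regions
  open import Data.Nat as ℕ using (ℕ; suc; _≤_; _<_; _<ᵇ_; s≤s)
  import Data.Nat.Properties as ℕ
  open import Data.Fin as Fin using (Fin; toℕ; fromℕ<)
  import Data.Fin.Properties as Fin
  open import Data.Fin.Permutation as Perm using (Permutation′; _⟨$⟩ʳ_; _⟨$⟩ˡ_)
  open import Data.Bool using (Bool; T)
  open import Data.List using (length; applyUpTo)
  open import Data.List.Relation.Unary.All.Properties using (applyUpTo⁺₁)
  open import Data.Product using (_,_; proj₁; proj₂)
  open import Data.Sum using (inj₁; inj₂)
  open import Function using (_⇔_; mk⇔)
  open import Relation.Nullary using (¬_; ¬?; yes; no; contradiction)
  open import Relation.Binary.PropositionalEquality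
  open import Relation.Binary.Construct.Closure.Equivalence using (EqClosure)
  open import Relation.Binary.Construct.Closure.Symmetric using (fwd)
  open import Relation.Binary.Construct.Closure.ReflexiveTransitive using (ε; _◅_)


  open Sorted {x = x} generic π decreasing
  open Ceilings {x = x} generic π decreasing

  w≤position : ∀ j → toℕ (w j) ≤ position j
  w≤position j = proj₂ (parking j) (π ⟨$⟩ˡ j) ε

  private
    early : ℕ → Fin (suc m) → Bool
    early i j = position j <ᵇ i

    early⇒below : ∀ i j → T (early i j) → T (toℕ (w j) <ᵇ i)
    early⇒below i j early = ℕ.<⇒<ᵇ (ℕ.≤-<-trans (w≤position j) (ℕ.<ᵇ⇒< (position j) i early))

    count-early : ∀ {i} → i ≤ suc m → countFin (early i) ≡ i
    count-early {i} i≤n = trans (countFin-permute π (λ p → toℕ p <ᵇ i)) (countFin-<ᵇ (suc m) i i≤n)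

  i≤lettersBelow : ∀ {i} → i ≤ suc m → i ≤ lettersBelow w i
  i≤lettersBelow {i} i≤n =
    subst (_≤ lettersBelow w i) (count-early i≤n) (countFin-mono (early i) (λ j → toℕ (w j) <ᵇ i) (early⇒below i))

  -- A letter below i at a position ≥ i is joined to that position by ceilings, one of which crosses i.
  lettersBelow≤i : ∀ {i} → i ≤ suc m → ¬ Crossed i → lettersBelow w i ≤ i
  lettersBelow≤i {i} i≤n open′ =
    subst (lettersBelow w i ≤_) (count-early i≤n) (countFin-mono (λ j → toℕ (w j) <ᵇ i) (early i) below⇒early)
    where
    below⇒early : ∀ j → T (toℕ (w j) <ᵇ i) → T (early i j)
    below⇒early j wj<i with position j ℕ.<? i
    ... | yes early = ℕ.<⇒<ᵇ early
    ... | no  late with EqClosure-crosses (λ p → toℕ p ℕ.<? i) (proj₁ (parking j)) (ℕ.<ᵇ⇒< (toℕ (w j)) i wj<i) late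
    ...   | p , q , ceiling , inj₁ (p<i , q≮i) = contradiction ((p , q) , ceiling⇒tied ceiling , p<i , ℕ.≮⇒≥ q≮i) open′
    ...   | p , q , ceiling , inj₂ (q<i , p≮i) =
      contradiction (ℕ.<-trans (proj₁ (ceiling⇒tied ceiling)) q<i) p≮i

  -- The far end q of a ceiling (p , q) crossing i is a late coordinate carrying a letter ≤ p < i.
  i<lettersBelow : ∀ {i} → Crossed i → i < lettersBelow w i
  i<lettersBelow {i} crossed with crossed⇒ceiling crossed
  ... | p , q , ceiling , p<i , i≤q = subst (_< lettersBelow w i) (count-early (ℕ.≤-trans i≤q (Fin.toℕ≤n q)))
          (countFin-mono-< (early i) (λ j → toℕ (w j) <ᵇ i) (early⇒below i) (π ⟨$⟩ʳ q) late below)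
    where
    position-q : position (π ⟨$⟩ʳ q) ≡ toℕ q
    position-q = cong toℕ (Perm.inverseˡ π)
    late : ¬ T (early i (π ⟨$⟩ʳ q))
    late early = ℕ.<-irrefl refl (ℕ.<-≤-trans (subst (_< i) position-q (ℕ.<ᵇ⇒< (position (π ⟨$⟩ʳ q)) i early)) i≤q)
    below : T (toℕ (w (π ⟨$⟩ʳ q)) <ᵇ i)
    below = ℕ.<⇒<ᵇ (ℕ.≤-<-trans (proj₂ (parking (π ⟨$⟩ʳ q)) p joined) p<i)
      where
      joined : EqClosure (CeilingRel x π) p (π ⟨$⟩ˡ (π ⟨$⟩ʳ q))
      joined = subst (EqClosure (CeilingRel x π) p) (sym (Perm.inverseˡ π)) (fwd ceiling ◅ ε)

  return⇔open : ∀ i → i < suc m → T (onDiagonalPoint (pathPoints (dyckPath w)) i) ⇔ (¬ Crossed i)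
  return⇔open i i<n = subst (λ i → T (onDiagonalPoint (pathPoints (dyckPath w)) i) ⇔ (¬ Crossed i)) (Fin.toℕ-fromℕ< i<n)
    (mk⇔ (λ ret crossed → ℕ.<-irrefl refl (ℕ.<-≤-trans (i<lettersBelow crossed) (return⇒lettersBelow≤ w k ret)))
         (λ open′ → lettersBelow≤⇒return w k (lettersBelow≤i (ℕ.<⇒≤ k<n) open′) (ℕ.≤-trans (ℕ.n≤1+n (toℕ k)) (i≤lettersBelow k<n))))
    where
    k = fromℕ< i<n
    k<n : toℕ k < suc m
    k<n = Fin.toℕ<n k

  open Dimension {x = x} generic π decreasing using (openCuts)

  returns≡openCuts : numReturns w ≡ length openCuts
  returns≡openCuts = countList≡length-filter (onDiagonalPoint (pathPoints (dyckPath w))) (λ i → ¬? (crossed? i)) (applyUpTo suc m)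
                       (applyUpTo⁺₁ suc m λ {k} k<m → return⇔open (suc k) (s≤s k<m))


open import Data.Nat using (_≤_)
open import Function using (_∘_)
open import Relation.Binary.PropositionalEquality using (subst; sym)
open Regions using (module Dimension)

lemma8p1 : (n : ℕ) → 1 ≤ n → (w : Fin n → Fin n) → IsParkingFunction w →
           (x : Pt n) → Generic x → (π : Permutation′ n) → DecreasingOrder x π →
           ShiParking x π w →
           DegreesOfFreedom x (numPrimeComponents w)
lemma8p1 (suc m) _ w _ x generic π decreasing parking =
  subst (DegreesOfFreedom x ∘ suc) (sym returns≡openCuts) translations-dim
  where
  open Dimension {x = x} generic π decreasing using (translations-dim)
  open Returns {x = x} generic π decreasing w parking using (returns≡openCuts)
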